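{- For every $n\ge1$ there is a bijection $\Phi_n$ from the set of permutations of $\{1,\dots,n\}$ onto the set of stripped registries whose range is contained in $\{1,\dots,n\}$, with the following properties: (a) if $\tau$ is a permutation of $\{1,\dots,p\}$, $p\ge2$, consisting of a single block (i.e. $\tau(p)=1$), then $\Phi_p(\tau)$ has range $\{1,\dots,p\}$ and consists of a single registry block; (b) for every permutation $\pi$ of $\{1,\dots,n\}$ with blocks $\beta_1,\dots,\beta_q$ (in order), $\Phi_n(\pi)$ is the concatenation $\mathcal R_1\mathcal R_2\cdots\mathcal R_q$, where $\mathcal R_t$ is empty if $\beta_t$ is a singlet block, and otherwise $\mathcal R_t$ is obtained from $\Phi_p(\tau_t)$, where $\tau_t$ is the pattern of $\beta_t$ and $p$ its length, by replacing each element $j$ of each family by the $j$-th smallest value of $\beta_t$ (keeping colors). In particular the image of each nonsinglet block is a registry block with the same set of values.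
   Context: Permutations are written in line notation $\pi(1)\cdots\pi(n)$. Blocks of $\pi$: let $i_1$ be the position of the value $1$, $i_2$ the position of $\min_{i>i_1}\pi(i)$, $i_3$ the position of $\min_{i>i_2}\pi(i)$, etc.; the blocks are the segments $\pi(i_{t-1}+1)\cdots\pi(i_t)$ ($i_0=0$); a singlet block is a block of length one. The pattern of a sequence of distinct integers of length $p$ is the permutation of $\{1,\dots,p\}$ obtained by replacing each entry by its rank. A nonsinglet family is a set of $\ge2$ positive integers colored red/blue with $\ge1$ red, $\ge1$ blue, every red larger than every blue. A stripped registry is a finite sequence $(F_1,\dots,F_k)$ ($k\ge0$) of pairwise disjoint nonsinglet families; its range is $\bigcup_iF_i$. Blocks of a registry: let $j_1$ be the index of the family containing the minimum of the range, $j_2$ the index of the family containing the minimum of $\bigcup_{i>j_1}F_i$, etc.; the registry blocks are $(F_{j_{t-1}+1},\dots,F_{j_t})$ ($j_0=0$). -}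

module Defs where

open import Data.Nat using (ℕ; zero; suc; _+_; _≤_; _<_; _<?_; _≟_; _⊓_)
open import Data.Nat.Properties using (≤-decTotalOrder)
open import Data.Bool using (Bool; true; false; if_then_else_)
open import Data.List using (List; []; _∷_; _++_; map; concat; length; filter; foldr; upTo)
open import Data.List.Membership.Propositional using (_∈_; _∉_)
open import Data.List.Membership.DecPropositional _≟_ using (_∈?_)
open import Data.List.Relation.Unary.All using (All)
open import Data.List.Relation.Unary.AllPairs using (AllPairs)
open import Data.List.Relation.Binary.Permutation.Propositional using (_↭_)
open import Data.Product using (_×_; _,_; proj₁; proj₂)
open import Relation.Nullary using (¬_; yes; no)
open import Relation.Binary.PropositionalEquality using (_≡_)
open import Data.List.Sort.MergeSort ≤-decTotalOrder using (sort)

interval : ℕ → List ℕ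
interval n = map suc (upTo n)

-- π is (the line notation π(1)⋯π(n) of) a permutation of {1,…,n}
IsPerm : ℕ → List ℕ → Set
IsPerm n π = π ↭ interval n

minimum : ℕ → List ℕ → ℕ
minimum x xs = foldr _⊓_ x xs

cutAfter : ℕ → List ℕ → List ℕ × List ℕ
cutAfter m [] = [] , []
cutAfter m (x ∷ xs) with x ≟ m
... | yes _ = (x ∷ []) , xs
... | no  _ = (x ∷ proj₁ (cutAfter m xs)) , proj₂ (cutAfter m xs)

-- blocks, exactly as in the paper: cut after the minimum, then after the
-- minimum of what remains, etc.  (fuel = length suffices)
blocksFuel : ℕ → List ℕ → List (List ℕ)
blocksFuel zero    _        = []
blocksFuel (suc f) []       = []
blocksFuel (suc f) (x ∷ xs) =
  proj₁ (cutAfter (minimum x xs) (x ∷ xs))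
    ∷ blocksFuel f (proj₂ (cutAfter (minimum x xs) (x ∷ xs)))

blocks : List ℕ → List (List ℕ)
blocks π = blocksFuel (length π) π

rank : List ℕ → ℕ → ℕ
rank l x = suc (length (filter (_<? x) l))

patternOf : List ℕ → List ℕ
patternOf l = map (rank l) l

-- j-th entry (1-indexed) of a list, default 0
nth : List ℕ → ℕ → ℕ
nth []       _             = 0
nth (x ∷ xs) zero          = 0
nth (x ∷ xs) (suc zero)    = x
nth (x ∷ xs) (suc (suc j)) = nth xs (suc j)

jthSmallest : List ℕ → ℕ → ℕ
jthSmallest β j = nth (sort β) j

-- A colored finite set of positive integers, stored canonically as the
-- strictly increasing list of its red elements and the strictly increasing
-- list of its blue elements.
record Family : Set where
  constructor fam
  field
    reds  : List ℕ
    blues : List ℕ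
open Family public

elems : Family → List ℕ
elems F = reds F ++ blues F

NonEmpty : List ℕ → Set
NonEmpty l = ¬ (l ≡ [])

-- nonsinglet family (≥1 red, ≥1 blue, every red larger than every blue,
-- positive integers; hence ≥ 2 elements). Strict sortedness = canonical form.
IsNonsingletFamily : Family → Set
IsNonsingletFamily F =
  AllPairs _<_ (reds F) × AllPairs _<_ (blues F) ×
  NonEmpty (reds F) × NonEmpty (blues F) ×
  All (λ x → 1 ≤ x) (elems F) ×
  All (λ r → All (λ b → b < r) (blues F)) (reds F)

Disjoint : Family → Family → Set
Disjoint F G = ∀ x → x ∈ elems F → x ∉ elems G

Registry : Set
Registry = List Family

IsStrippedRegistry : Registry → Set
IsStrippedRegistry R = All IsNonsingletFamily R × AllPairs Disjoint R

range : Registry → List ℕ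
range R = concat (map elems R)

RangeWithin : ℕ → Registry → Set
RangeWithin n R = All (λ x → x ≤ n) (range R)

RangeIs : ℕ → Registry → Set
RangeIs p R = ∀ x → (x ∈ range R → 1 ≤ x × x ≤ p) × (1 ≤ x × x ≤ p → x ∈ range R)

containsB : ℕ → Family → Bool
containsB m F with m ∈? elems F
... | yes _ = true
... | no  _ = false

cutRegAfter : ℕ → Registry → Registry × Registry
cutRegAfter m [] = [] , []
cutRegAfter m (F ∷ Fs) =
  if containsB m F then ((F ∷ []) , Fs)
  else ((F ∷ proj₁ (cutRegAfter m Fs)) , proj₂ (cutRegAfter m Fs))

-- minimum of the range (0 if the range is empty, which never happens for
-- nonempty stripped registries)
minRange : Registry → ℕ
minRange R with range R
... | []     = 0
... | x ∷ xs = minimum x xs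

regBlocksFuel : ℕ → Registry → List Registry
regBlocksFuel zero    _  = []
regBlocksFuel (suc f) [] = []
regBlocksFuel (suc f) R@(_ ∷ _) =
  proj₁ (cutRegAfter (minRange R) R) ∷ regBlocksFuel f (proj₂ (cutRegAfter (minRange R) R))

registryBlocks : Registry → List Registry
registryBlocks R = regBlocksFuel (length R) R

relabelFam : List ℕ → Family → Family
relabelFam β F = fam (map (jthSmallest β) (reds F)) (map (jthSmallest β) (blues F))

blockImage : (ℕ → List ℕ → Registry) → List ℕ → Registry
blockImage Φ []           = []
blockImage Φ (x ∷ [])     = []
blockImage Φ β@(_ ∷ _ ∷ _) = map (relabelFam β) (Φ (length β) (patternOf β))

IsBijectionOnto : ℕ → (List ℕ → Registry) → Set
IsBijectionOnto n f =
  (∀ π → IsPerm n π → IsStrippedRegistry (f π) × RangeWithin n (f π)) ×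
  (∀ π σ → IsPerm n π → IsPerm n σ → f π ≡ f σ → π ≡ σ) ×
  (∀ R → IsStrippedRegistry R → RangeWithin n R → Data.Product.∃ λ π → IsPerm n π × f π ≡ R)

module Submission where

-- Φ encodes a word block by block (`encode`): a singlet block contributes nothing, and a
-- block a σ v (v its minimum) contributes the encoding G of its interior σ followed by one
-- new family F, the letters of the block not used by G, coloured red when ≥ a, blue when < a.

open import Defs
open import Data.Nat using (ℕ; zero; suc; _≤_; _<_; _<?_; _≤?_; _≟_; _⊓_; z≤n; s≤s)
open import Data.Nat.Properties
open import Data.List using (List; []; _∷_; _++_; [_]; map; concat; length; filter; upTo)
open import Data.List.Properties
  using (map-++; length-map; length-++; ++-assoc; ++-identityʳ; length-filter; filter-accept; filter-reject;
         filter-none; concat-map; map-∘; map-id-local; map-cong-local; length-upTo)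
open import Data.List.Membership.Propositional using (_∈_; _∉_)
open import Data.List.Membership.Propositional.Properties
  using (∈-++⁺ˡ; ∈-++⁺ʳ; ∈-++⁻; ∈-map⁺; ∈-map⁻; ∈-filter⁺; ∈-filter⁻; ∈-upTo⁺; ∈-upTo⁻)
open import Data.List.Membership.DecPropositional _≟_ using (_∈?_)
open import Data.List.Relation.Unary.All as All using (All; []; _∷_)
import Data.List.Relation.Unary.All.Properties as All
open import Data.List.Relation.Unary.Any using (here; there)
open import Data.List.Relation.Unary.AllPairs as AllPairs using (AllPairs; []; _∷_)
import Data.List.Relation.Unary.AllPairs.Properties as AllPairs
open import Data.List.Relation.Unary.Linked using ([]; [-]; _∷_)
open import Data.List.Relation.Unary.Linked.Properties using (Linked⇒AllPairs)
open import Data.List.Relation.Unary.Sorted.TotalOrder ≤-totalOrder using (Sorted)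
open import Data.List.Relation.Unary.Sorted.TotalOrder.Properties using (↗↭↗⇒≋)
open import Data.List.Relation.Binary.Pointwise using (Pointwise-≡⇒≡)
open import Data.List.Relation.Binary.Sublist.Propositional using (⊆-refl)
open import Data.List.Relation.Binary.Sublist.Propositional.Properties using () renaming (filter⁺ to sublist-filter⁺)
open import Data.List.Relation.Binary.Sublist.Heterogeneous.Properties using (length-mono-≤)
open import Data.List.Relation.Binary.Permutation.Propositional
  using (_↭_; ↭-sym; ↭-trans; ↭⇒↭ₛ)
open import Data.List.Relation.Binary.Permutation.Propositional.Properties
  using (∈-resp-↭; ↭-length; filter-↭; map⁺)
open import Data.List.Sort.MergeSort ≤-decTotalOrder using (sort)
open import Data.List.Sort.MergeSort.Properties ≤-decTotalOrder using (sort-↭; sort-↗)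
open import Data.Bool using (true; false)
open import Data.Product using (Σ; ∃; ∃₂; _×_; _,_; proj₁; proj₂)
open import Data.Sum using (_⊎_; inj₁; inj₂) renaming ([_,_] to either)
open import Data.Empty using (⊥-elim)
open import Relation.Nullary using (yes; no; ¬?)
open import Relation.Nullary.Decidable using (_×-dec_)
open import Relation.Unary using (Decidable)
open import Relation.Binary.Definitions using (tri<; tri≈; tri>)
open import Relation.Binary.PropositionalEquality
  using (_≡_; _≢_; refl; sym; trans; cong; cong₂; subst; setoid; module ≡-Reasoning)
open import Data.List.Relation.Binary.Permutation.Setoid.Properties (setoid ℕ) using (Unique-resp-↭)

-- Finite sets of naturals are represented by lists; words are lists of distinct letters.

Sub : List ℕ → List ℕ → Set
Sub X Y = ∀ {x} → x ∈ X → x ∈ Y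

_≈ₛ_ : List ℕ → List ℕ → Set
X ≈ₛ Y = ∀ x → (x ∈ X → x ∈ Y) × (x ∈ Y → x ∈ X)

Distinct : List ℕ → Set
Distinct = AllPairs _≢_

Increasing : List ℕ → Set
Increasing = AllPairs _<_

Positive : List ℕ → Set
Positive = All (1 ≤_)

increasing⇒distinct : ∀ {xs} → Increasing xs → Distinct xs
increasing⇒distinct = AllPairs.map (λ x<y x≡y → <-irrefl x≡y x<y)

distinct-resp-↭ : ∀ {xs ys} → xs ↭ ys → Distinct xs → Distinct ys
distinct-resp-↭ p = Unique-resp-↭ (↭⇒↭ₛ p)

allPairs-++⁻ : ∀ {A : Set} {R : A → A → Set} (xs : List A) {ys} → AllPairs R (xs ++ ys) →
               AllPairs R xs × AllPairs R ys × All (λ x → All (R x) ys) xs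
allPairs-++⁻ [] p = [] , p , []
allPairs-++⁻ (x ∷ xs) (px ∷ p) with allPairs-++⁻ xs p
... | l , r , c = (proj₁ (All.++⁻ xs px) ∷ l) , r , (proj₂ (All.++⁻ xs px) ∷ c)

distinct-apart : ∀ xs {ys x y} → Distinct (xs ++ ys) → x ∈ xs → y ∈ ys → x ≢ y
distinct-apart xs d x∈ y∈ = All.lookup (All.lookup (proj₂ (proj₂ (allPairs-++⁻ xs d))) x∈) y∈

distinct-later : ∀ pre {v post} → Distinct (pre ++ v ∷ post) → v ∉ post
distinct-later pre d v∈ = All.lookup (AllPairs.head (proj₁ (proj₂ (allPairs-++⁻ pre d)))) v∈ refl

increasing-head : ∀ {x xs y} → Increasing (x ∷ xs) → y ∈ x ∷ xs → x ≤ y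
increasing-head _ (here refl) = ≤-refl
increasing-head (px ∷ _) (there y∈) = <⇒≤ (All.lookup px y∈)

increasing-unique : ∀ {xs ys} → Increasing xs → Increasing ys → xs ≈ₛ ys → xs ≡ ys
increasing-unique {[]} {[]} _ _ _ = refl
increasing-unique {[]} {y ∷ ys} _ _ e with () ← proj₂ (e y) (here refl)
increasing-unique {x ∷ xs} {[]} _ _ e with () ← proj₁ (e x) (here refl)
increasing-unique {x ∷ xs} {y ∷ ys} ixs@(px ∷ sx) iys@(py ∷ sy) e =
  cong₂ _∷_ x≡y (increasing-unique sx sy tails)
  where
  x≡y : x ≡ y
  x≡y = ≤-antisym (increasing-head ixs (proj₂ (e y) (here refl))) (increasing-head iys (proj₁ (e x) (here refl)))
  drop-head : ∀ {z u us} → Increasing (u ∷ us) → z ∈ u ∷ us → x < z → u ≡ x → z ∈ us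
  drop-head _ (here refl) x<z refl = ⊥-elim (<-irrefl refl x<z)
  drop-head _ (there z∈) _ _ = z∈
  tails : xs ≈ₛ ys
  tails z = (λ z∈ → drop-head iys (proj₁ (e z) (there z∈)) (All.lookup px z∈) (sym x≡y))
          , (λ z∈ → drop-head ixs (proj₂ (e z) (there z∈)) (subst (_< z) (sym x≡y) (All.lookup py z∈)) refl)

∈sort⁺ : ∀ {x xs} → x ∈ xs → x ∈ sort xs
∈sort⁺ {xs = xs} = ∈-resp-↭ (↭-sym (sort-↭ xs))

∈sort⁻ : ∀ {x xs} → x ∈ sort xs → x ∈ xs
∈sort⁻ {xs = xs} = ∈-resp-↭ (sort-↭ xs)

sort-unique : ∀ {xs ys} → Sorted ys → xs ↭ ys → sort xs ≡ ys
sort-unique {xs} s p = Pointwise-≡⇒≡ (↗↭↗⇒≋ ≤-totalOrder (sort-↗ xs) s (↭⇒↭ₛ (↭-trans (sort-↭ xs) p)))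

sort-increasing : ∀ {xs} → Distinct xs → Increasing (sort xs)
sort-increasing {xs} d =
  AllPairs.zipWith (λ (x≤y , x≢y) → ≤∧≢⇒< x≤y x≢y)
    (Linked⇒AllPairs ≤-trans (sort-↗ xs) , distinct-resp-↭ (↭-sym (sort-↭ xs)) d)

distinct-≈⇒↭ : ∀ {π V} → Distinct π → Increasing V → π ≈ₛ V → π ↭ V
distinct-≈⇒↭ {π} d iV e = subst (π ↭_) sorted (↭-sym (sort-↭ π))
  where
  sorted : sort π ≡ _
  sorted = increasing-unique (sort-increasing d) iV
             (λ x → (λ x∈ → proj₁ (e x) (∈sort⁻ x∈)) , (λ x∈ → ∈sort⁺ (proj₂ (e x) x∈)))

minimum-spec : ∀ x xs → minimum x xs ∈ x ∷ xs × All (minimum x xs ≤_) (x ∷ xs)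
minimum-spec x [] = here refl , (≤-refl ∷ [])
minimum-spec x (y ∷ ys) with minimum-spec x ys
... | m∈ , (m≤x ∷ m≤ys) = member (⊓-sel y (minimum x ys)) , bound
  where
  member : y ⊓ minimum x ys ≡ y ⊎ y ⊓ minimum x ys ≡ minimum x ys → y ⊓ minimum x ys ∈ x ∷ y ∷ ys
  member (inj₁ e) = subst (_∈ x ∷ y ∷ ys) (sym e) (there (here refl))
  member (inj₂ e) = subst (_∈ x ∷ y ∷ ys) (sym e) (shift m∈)
    where
    shift : ∀ {z} → z ∈ x ∷ ys → z ∈ x ∷ y ∷ ys
    shift (here p) = here p
    shift (there p) = there (there p)
  bound : All (y ⊓ minimum x ys ≤_) (x ∷ y ∷ ys)
  bound = ≤-trans (m⊓n≤n y _) m≤x ∷ m⊓n≤m y _ ∷ All.map (≤-trans (m⊓n≤n y _)) m≤ys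

minimum-unique : ∀ {v x xs} → v ∈ x ∷ xs → All (v ≤_) (x ∷ xs) → minimum x xs ≡ v
minimum-unique {x = x} {xs} v∈ v≤ with minimum-spec x xs
... | m∈ , m≤ = ≤-antisym (All.lookup m≤ v∈) (All.lookup v≤ m∈)

cutAfter-++ : ∀ m pre post → m ∉ pre → cutAfter m (pre ++ m ∷ post) ≡ (pre ++ [ m ] , post)
cutAfter-++ m [] post _ with m ≟ m
... | yes _ = refl
... | no m≢m = ⊥-elim (m≢m refl)
cutAfter-++ m (x ∷ pre) post m∉ with x ≟ m
... | yes x≡m = ⊥-elim (m∉ (here (sym x≡m)))
... | no _ rewrite cutAfter-++ m pre post (λ m∈ → m∉ (there m∈)) = refl

split-at : ∀ m w → m ∈ w → ∃₂ λ pre post → w ≡ pre ++ m ∷ post × m ∉ pre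
split-at m (x ∷ w) m∈ with x ≟ m
... | yes x≡m = [] , w , cong (_∷ w) x≡m , λ ()
split-at m (x ∷ w) (here m≡x) | no x≢m = ⊥-elim (x≢m (sym m≡x))
split-at m (x ∷ w) (there m∈) | no x≢m with split-at m w m∈
... | pre , post , refl , m∉ = x ∷ pre , post , refl , λ { (here m≡x) → x≢m (sym m≡x) ; (there p) → m∉ p }

cutAfter-++-both : ∀ m w → proj₁ (cutAfter m w) ++ proj₂ (cutAfter m w) ≡ w
cutAfter-++-both m [] = refl
cutAfter-++-both m (x ∷ w) with x ≟ m
... | yes _ = refl
... | no _ = cong (x ∷_) (cutAfter-++-both m w)

cutAfter-rest-length : ∀ m w → length (proj₂ (cutAfter m w)) ≤ length w
cutAfter-rest-length m [] = z≤n
cutAfter-rest-length m (x ∷ w) with x ≟ m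
... | yes _ = n≤1+n _
... | no _ = m≤n⇒m≤1+n (cutAfter-rest-length m w)

cutAfter-rest-shorter : ∀ m x w → length (proj₂ (cutAfter m (x ∷ w))) ≤ length w
cutAfter-rest-shorter m x w with x ≟ m
... | yes _ = ≤-refl
... | no _ = cutAfter-rest-length m w

blocksFuel-adequate : ∀ f g w → length w ≤ f → length w ≤ g → blocksFuel f w ≡ blocksFuel g w
blocksFuel-adequate zero zero [] _ _ = refl
blocksFuel-adequate zero (suc g) [] _ _ = refl
blocksFuel-adequate (suc f) zero [] _ _ = refl
blocksFuel-adequate (suc f) (suc g) [] _ _ = refl
blocksFuel-adequate (suc f) (suc g) (x ∷ w) (s≤s lf) (s≤s lg) =
  cong (_ ∷_) (blocksFuel-adequate f g _ (≤-trans (cutAfter-rest-shorter _ x w) lf) (≤-trans (cutAfter-rest-shorter _ x w) lg))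

blocks-step : ∀ x xs → blocks (x ∷ xs) ≡
  proj₁ (cutAfter (minimum x xs) (x ∷ xs)) ∷ blocks (proj₂ (cutAfter (minimum x xs) (x ∷ xs)))
blocks-step x xs = cong (proj₁ (cutAfter (minimum x xs) (x ∷ xs)) ∷_) (blocksFuel-adequate (length xs) _ _ (cutAfter-rest-shorter _ x xs) ≤-refl)

blocks-first : ∀ pre v post → All (v <_) pre → All (v <_) post →
               blocks (pre ++ v ∷ post) ≡ (pre ++ [ v ]) ∷ blocks post
blocks-first [] v post _ v<post = trans (blocks-step v post) (cong (λ c → proj₁ c ∷ blocks (proj₂ c)) cut)
  where
  cut : cutAfter (minimum v post) (v ∷ post) ≡ ([ v ] , post)
  cut rewrite minimum-unique (here refl) (≤-refl ∷ All.map <⇒≤ v<post) = cutAfter-++ v [] post λ ()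
blocks-first (x ∷ pre) v post v<pre v<post =
  trans (blocks-step x (pre ++ v ∷ post)) (cong (λ c → proj₁ c ∷ blocks (proj₂ c)) cut)
  where
  v∉pre : v ∉ x ∷ pre
  v∉pre v∈ = <-irrefl refl (All.lookup v<pre v∈)
  v-min : minimum x (pre ++ v ∷ post) ≡ v
  v-min = minimum-unique (∈-++⁺ʳ (x ∷ pre) (here refl))
            (All.++⁺ (All.map <⇒≤ v<pre) (≤-refl ∷ All.map <⇒≤ v<post))
  cut : cutAfter (minimum x (pre ++ v ∷ post)) (x ∷ pre ++ v ∷ post) ≡ (x ∷ pre ++ [ v ] , post)
  cut rewrite v-min = cutAfter-++ v (x ∷ pre) post v∉pre

split-at-minimum : ∀ x xs → Distinct (x ∷ xs) → ∃₂ λ pre post → ∃ λ v →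
  x ∷ xs ≡ pre ++ v ∷ post × All (v <_) pre × All (v <_) post
split-at-minimum x xs d with minimum-spec x xs
... | m∈ , m≤ with split-at _ (x ∷ xs) m∈
... | pre , post , eq , m∉pre = pre , post , _ , eq , above pre (proj₁ bounds) m∉pre , above post (All.tail (proj₂ bounds)) m∉post
  where
  bounds : All (minimum x xs ≤_) pre × All (minimum x xs ≤_) (minimum x xs ∷ post)
  bounds = All.++⁻ pre (subst (All (minimum x xs ≤_)) eq m≤)
  m∉post : minimum x xs ∉ post
  m∉post = distinct-later pre (subst Distinct eq d)
  above : ∀ l → All (minimum x xs ≤_) l → minimum x xs ∉ l → All (minimum x xs <_) l
  above l m≤l m∉l = All.tabulate λ z∈ → ≤∧≢⇒< (All.lookup m≤l z∈) (λ m≡z → m∉l (subst (_∈ l) (sym m≡z) z∈))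

rest-shorter : ∀ (pre : List ℕ) v post → length post < length (pre ++ v ∷ post)
rest-shorter pre v post rewrite length-++ pre {v ∷ post} = m≤n+m (suc (length post)) (length pre)

block-induction : (P : List ℕ → Set) → P [] →
  (∀ pre v post → Distinct (pre ++ v ∷ post) → All (v <_) pre → All (v <_) post →
     blocks (pre ++ v ∷ post) ≡ (pre ++ [ v ]) ∷ blocks post → P post → P (pre ++ v ∷ post)) →
  ∀ w → Distinct w → P w
block-induction P base step w = go (suc (length w)) w ≤-refl
  where
  go : ∀ n w → length w < n → Distinct w → P w
  go n [] _ _ = base
  go (suc n) (x ∷ xs) (s≤s len) d with split-at-minimum x xs d
  ... | pre , post , v , eq , v<pre , v<post =
    subst P (sym eq) (step pre v post d′ v<pre v<post (blocks-first pre v post v<pre v<post)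
      (go n post (≤-trans (rest-shorter pre v post) (subst (λ w → length w ≤ n) eq len))
              (AllPairs.tail (proj₁ (proj₂ (allPairs-++⁻ pre d′))))))
    where
    d′ : Distinct (pre ++ v ∷ post)
    d′ = subst Distinct eq d

blocks-sublists : ∀ w → All (λ β → Sub β w × length β ≤ length w) (blocks w)
blocks-sublists w = go (length w) w
  where
  go : ∀ f w → All (λ β → Sub β w × length β ≤ length w) (blocksFuel f w)
  go zero w = []
  go (suc f) [] = []
  go (suc f) (x ∷ xs) =
    ((λ {_} y∈ → into-w (∈-++⁺ˡ y∈)) , first-len) ∷
    All.map (λ (sub , len) → (λ {_} y∈ → into-w (∈-++⁺ʳ (proj₁ c) (sub y∈))) , ≤-trans len rest-len) (go f _)
    where
    c : List ℕ × List ℕ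
    c = cutAfter (minimum x xs) (x ∷ xs)
    rebuild : proj₁ c ++ proj₂ c ≡ x ∷ xs
    rebuild = cutAfter-++-both (minimum x xs) (x ∷ xs)
    into-w : ∀ {y} → y ∈ proj₁ c ++ proj₂ c → y ∈ x ∷ xs
    into-w = subst (_ ∈_) rebuild
    first-len : length (proj₁ c) ≤ length (x ∷ xs)
    first-len = subst (length (proj₁ c) ≤_) (trans (sym (length-++ (proj₁ c))) (cong length rebuild)) (m≤m+n _ _)
    rest-len : length (proj₂ c) ≤ length (x ∷ xs)
    rest-len = cutAfter-rest-length _ (x ∷ xs)

range-++ : ∀ R₁ R₂ → range (R₁ ++ R₂) ≡ range R₁ ++ range R₂
range-++ [] R₂ = refl
range-++ (F ∷ R₁) R₂ rewrite range-++ R₁ R₂ = sym (++-assoc (elems F) (range R₁) (range R₂))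

range-snoc : ∀ G F → range (G ++ [ F ]) ≡ range G ++ elems F
range-snoc G F = trans (range-++ G [ F ]) (cong (range G ++_) (++-identityʳ (elems F)))

∈range-++⁻ : ∀ R₁ {R₂ x} → x ∈ range (R₁ ++ R₂) → x ∈ range R₁ ⊎ x ∈ range R₂
∈range-++⁻ R₁ {R₂} x∈ = ∈-++⁻ (range R₁) (subst (_ ∈_) (range-++ R₁ R₂) x∈)

∈range-++⁺ˡ : ∀ R₁ {R₂ x} → x ∈ range R₁ → x ∈ range (R₁ ++ R₂)
∈range-++⁺ˡ R₁ {R₂} x∈ = subst (_ ∈_) (sym (range-++ R₁ R₂)) (∈-++⁺ˡ x∈)

∈range-++⁺ʳ : ∀ R₁ {R₂ x} → x ∈ range R₂ → x ∈ range (R₁ ++ R₂)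
∈range-++⁺ʳ R₁ {R₂} x∈ = subst (_ ∈_) (sym (range-++ R₁ R₂)) (∈-++⁺ʳ (range R₁) x∈)

family⊆range : ∀ {F} R → F ∈ R → Sub (elems F) (range R)
family⊆range (G ∷ R) (here refl) x∈ = ∈-++⁺ˡ x∈
family⊆range (G ∷ R) (there F∈) x∈ = ∈-++⁺ʳ (elems G) (family⊆range R F∈ x∈)

range⊆families : ∀ R {x} → x ∈ range R → ∃ λ F → F ∈ R × x ∈ elems F
range⊆families (F ∷ R) x∈ with ∈-++⁻ (elems F) x∈
... | inj₁ x∈F = F , here refl , x∈F
... | inj₂ x∈R with range⊆families R x∈R
... | G , G∈ , x∈G = G , there G∈ , x∈G

colourAt : ℕ → List ℕ → Family
colourAt a S = fam (filter (a ≤?_) S) (filter (_<? a) S)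

notIn? : (X : List ℕ) → Decidable (_∉ X)
notIn? X x = ¬? (x ∈? X)

unused : Registry → List ℕ → List ℕ
unused G β = filter (notIn? (range G)) (sort β)

closeBlock : ℕ → List ℕ → Registry → Registry
closeBlock a β G = G ++ [ colourAt a (unused G β) ]

dropLast : ℕ → List ℕ → List ℕ
dropLast y [] = []
dropLast y (z ∷ zs) = y ∷ dropLast z zs

-- the fuel f bounds the recursion depth; any f > length w gives the same result (encode-adequate)
mutual
  encode : ℕ → List ℕ → Registry
  encode zero w = []
  encode (suc f) w = concat (map (encodeBlock f) (blocks w))

  encodeBlock : ℕ → List ℕ → Registry
  encodeBlock f [] = []
  encodeBlock f (x ∷ []) = []
  encodeBlock f (a ∷ y ∷ ys) = closeBlock a (a ∷ y ∷ ys) (encode f (dropLast y ys))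

encode-[] : ∀ f → encode f [] ≡ []
encode-[] zero = refl
encode-[] (suc f) = refl

dropLast-snoc : ∀ s ss v → dropLast s (ss ++ [ v ]) ≡ s ∷ ss
dropLast-snoc s [] v = refl
dropLast-snoc s (t ∷ ts) v = cong (s ∷_) (dropLast-snoc t ts v)

dropLast-length : ∀ y ys → length (dropLast y ys) ≡ length ys
dropLast-length y [] = refl
dropLast-length y (z ∷ zs) = cong suc (dropLast-length z zs)

dropLast-sub : ∀ y ys → Sub (dropLast y ys) (y ∷ ys)
dropLast-sub y (z ∷ zs) (here e) = here e
dropLast-sub y (z ∷ zs) (there x∈) = there (dropLast-sub z zs x∈)

encodeBlock-shape : ∀ f a σ v → encodeBlock f (a ∷ σ ++ [ v ]) ≡ closeBlock a (a ∷ σ ++ [ v ]) (encode f σ)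
encodeBlock-shape f a [] v = refl
encodeBlock-shape f a (s ∷ ss) v rewrite dropLast-snoc s ss v = refl

encode-first-block : ∀ f w β post → blocks w ≡ β ∷ blocks post →
                     encode (suc f) w ≡ encodeBlock f β ++ encode (suc f) post
encode-first-block f w β post eq rewrite eq = refl

encode-block-cons : ∀ f a σ v post → blocks (a ∷ σ ++ v ∷ post) ≡ (a ∷ σ ++ [ v ]) ∷ blocks post →
  encode (suc f) (a ∷ σ ++ v ∷ post) ≡ closeBlock a (a ∷ σ ++ [ v ]) (encode f σ) ++ encode (suc f) post
encode-block-cons f a σ v post eq =
  trans (encode-first-block f (a ∷ σ ++ v ∷ post) (a ∷ σ ++ [ v ]) post eq) (cong (_++ encode (suc f) post) (encodeBlock-shape f a σ v))

mutual
  encode-adequate : ∀ f g w → length w < f → length w < g → encode f w ≡ encode g w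
  encode-adequate (suc f) (suc g) w (s≤s lf) (s≤s lg) =
    cong concat (map-cong-local (All.map (λ {β} (_ , len) → encodeBlock-adequate f g β (≤-trans len lf) (≤-trans len lg))
                                         (blocks-sublists w)))

  encodeBlock-adequate : ∀ f g β → length β ≤ f → length β ≤ g → encodeBlock f β ≡ encodeBlock g β
  encodeBlock-adequate f g [] _ _ = refl
  encodeBlock-adequate f g (x ∷ []) _ _ = refl
  encodeBlock-adequate f g (a ∷ y ∷ ys) lf lg =
    cong (closeBlock a (a ∷ y ∷ ys)) (encode-adequate f g (dropLast y ys) (shorter lf) (shorter lg))
    where
    shorter : ∀ {h} → length (a ∷ y ∷ ys) ≤ h → length (dropLast y ys) < h
    shorter l rewrite dropLast-length y ys = ≤-trans (n≤1+n _) l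

colourAt-elems⁻ : ∀ a S {x} → x ∈ elems (colourAt a S) → x ∈ S
colourAt-elems⁻ a S x∈ with ∈-++⁻ (filter (a ≤?_) S) x∈
... | inj₁ x∈r = proj₁ (∈-filter⁻ (a ≤?_) x∈r)
... | inj₂ x∈b = proj₁ (∈-filter⁻ (_<? a) x∈b)

colourAt-elems⁺ : ∀ a S {x} → x ∈ S → x ∈ elems (colourAt a S)
colourAt-elems⁺ a S {x} x∈ with a ≤? x
... | yes a≤x = ∈-++⁺ˡ (∈-filter⁺ (a ≤?_) x∈ a≤x)
... | no a≰x = ∈-++⁺ʳ (filter (a ≤?_) S) (∈-filter⁺ (_<? a) x∈ (≰⇒> a≰x))

unused⁻ : ∀ G β {x} → x ∈ unused G β → x ∈ β × x ∉ range G
unused⁻ G β x∈ with ∈-filter⁻ (notIn? (range G)) x∈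
... | x∈s , x∉G = ∈sort⁻ x∈s , x∉G

unused⁺ : ∀ G β {x} → x ∈ β → x ∉ range G → x ∈ unused G β
unused⁺ G β x∈ x∉G = ∈-filter⁺ (notIn? (range G)) (∈sort⁺ x∈) x∉G

newFamily⁻ : ∀ a β G {x} → x ∈ elems (colourAt a (unused G β)) → x ∈ β × x ∉ range G
newFamily⁻ a β G x∈ = unused⁻ G β (colourAt-elems⁻ a _ x∈)

closeBlock-covers : ∀ a β G → Sub β (range (closeBlock a β G))
closeBlock-covers a β G {x} x∈ rewrite range-snoc G (colourAt a (unused G β)) with x ∈? range G
... | yes x∈G = ∈-++⁺ˡ x∈G
... | no x∉G = ∈-++⁺ʳ (range G) (colourAt-elems⁺ a _ (unused⁺ G β x∈ x∉G))

∈range-concat⁻ : ∀ (h : List ℕ → Registry) βs {x} → x ∈ range (concat (map h βs)) → ∃ λ β → β ∈ βs × x ∈ range (h β)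
∈range-concat⁻ h (β ∷ βs) x∈ with ∈range-++⁻ (h β) x∈
... | inj₁ x∈β = β , here refl , x∈β
... | inj₂ x∈rest with ∈range-concat⁻ h βs x∈rest
... | γ , γ∈ , x∈γ = γ , there γ∈ , x∈γ

mutual
  encode-range : ∀ f w → Sub (range (encode f w)) w
  encode-range zero w ()
  encode-range (suc f) w x∈ with ∈range-concat⁻ (encodeBlock f) (blocks w) x∈
  ... | β , β∈ , x∈β = proj₁ (All.lookup (blocks-sublists w) β∈) (encodeBlock-range f β x∈β)

  encodeBlock-range : ∀ f β → Sub (range (encodeBlock f β)) β
  encodeBlock-range f [] ()
  encodeBlock-range f (x ∷ []) ()
  encodeBlock-range f (a ∷ y ∷ ys) x∈
    rewrite range-snoc (encode f (dropLast y ys)) (colourAt a (unused (encode f (dropLast y ys)) (a ∷ y ∷ ys)))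
    with ∈-++⁻ (range (encode f (dropLast y ys))) x∈
  ... | inj₁ x∈G = there (dropLast-sub y ys (encode-range f (dropLast y ys) x∈G))
  ... | inj₂ x∈F = proj₁ (newFamily⁻ a (a ∷ y ∷ ys) (encode f (dropLast y ys)) x∈F)

interior-shorter : ∀ (a : ℕ) σ v post → length σ < length (a ∷ σ ++ v ∷ post)
interior-shorter a σ v post rewrite length-++ σ {v ∷ post} = s≤s (m≤m+n (length σ) (suc (length post)))

first-block-++ : ∀ (a : ℕ) σ v post → a ∷ σ ++ v ∷ post ≡ (a ∷ σ ++ [ v ]) ++ post
first-block-++ a σ v post = cong (a ∷_) (sym (++-assoc σ [ v ] post))

block-members : ∀ {a : ℕ} {σ v x} → x ∈ a ∷ σ ++ [ v ] → x ≡ a ⊎ x ∈ σ ⊎ x ≡ v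
block-members (here x≡a) = inj₁ x≡a
block-members {σ = σ} (there x∈) with ∈-++⁻ σ x∈
... | inj₁ x∈σ = inj₂ (inj₁ x∈σ)
... | inj₂ (here x≡v) = inj₂ (inj₂ x≡v)

block-distinct : ∀ a σ v post → Distinct (a ∷ σ ++ v ∷ post) →
  Distinct (a ∷ σ ++ [ v ]) × Distinct σ × (∀ {x} → x ∈ a ∷ σ ++ [ v ] → x ∉ post)
block-distinct a σ v post d = dβ , proj₁ (allPairs-++⁻ σ (AllPairs.tail dβ)) , λ x∈β x∈post → apart x∈β x∈post refl
  where
  d′ : Distinct ((a ∷ σ ++ [ v ]) ++ post)
  d′ = subst Distinct (first-block-++ a σ v post) d
  dβ : Distinct (a ∷ σ ++ [ v ])
  dβ = proj₁ (allPairs-++⁻ (a ∷ σ ++ [ v ]) d′)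
  apart : ∀ {x y} → x ∈ a ∷ σ ++ [ v ] → y ∈ post → x ≢ y
  apart = distinct-apart (a ∷ σ ++ [ v ]) d′

valid-++ : ∀ {R₁ R₂} → IsStrippedRegistry R₁ → IsStrippedRegistry R₂ →
           (∀ {x} → x ∈ range R₁ → x ∉ range R₂) → IsStrippedRegistry (R₁ ++ R₂)
valid-++ {R₁} {R₂} (fam₁ , dis₁) (fam₂ , dis₂) apart =
  All.++⁺ fam₁ fam₂ ,
  AllPairs.++⁺ dis₁ dis₂ (All.tabulate λ F∈ → All.tabulate λ G∈ x x∈F x∈G →
    apart (family⊆range R₁ F∈ x∈F) (family⊆range R₂ G∈ x∈G))

valid-++⁻ : ∀ R₁ {R₂} → IsStrippedRegistry (R₁ ++ R₂) →
            IsStrippedRegistry R₁ × IsStrippedRegistry R₂ × (∀ {x} → x ∈ range R₁ → x ∉ range R₂)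
valid-++⁻ R₁ {R₂} (fams , dis) with All.++⁻ R₁ fams | allPairs-++⁻ R₁ dis
... | fam₁ , fam₂ | dis₁ , dis₂ , cross = (fam₁ , dis₁) , (fam₂ , dis₂) , apart
  where
  apart : ∀ {x} → x ∈ range R₁ → x ∉ range R₂
  apart x∈₁ x∈₂ with range⊆families R₁ x∈₁ | range⊆families R₂ x∈₂
  ... | F , F∈ , x∈F | G , G∈ , x∈G = All.lookup (All.lookup cross F∈) G∈ _ x∈F x∈G

nonEmpty : ∀ {x} {l : List ℕ} → x ∈ l → NonEmpty l
nonEmpty () refl

colourAt-nonsinglet : ∀ a v S → Increasing S → Positive S → a ∈ S → v ∈ S → v < a →
                      IsNonsingletFamily (colourAt a S)
colourAt-nonsinglet a v S inc pos a∈ v∈ v<a =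
  AllPairs.filter⁺ (a ≤?_) inc , AllPairs.filter⁺ (_<? a) inc ,
  nonEmpty (∈-filter⁺ (a ≤?_) a∈ ≤-refl) , nonEmpty (∈-filter⁺ (_<? a) v∈ v<a) ,
  All.tabulate (λ x∈ → All.lookup pos (colourAt-elems⁻ a S x∈)) ,
  All.tabulate λ r∈ → All.tabulate λ b∈ →
    <-≤-trans (proj₂ (∈-filter⁻ (_<? a) {xs = S} b∈)) (proj₂ (∈-filter⁻ (a ≤?_) {xs = S} r∈))

closeBlock-valid : ∀ a σ v G → Distinct (a ∷ σ ++ [ v ]) → Positive (a ∷ σ ++ [ v ]) → All (v <_) (a ∷ σ) →
                   Sub (range G) σ → IsStrippedRegistry G → IsStrippedRegistry (closeBlock a (a ∷ σ ++ [ v ]) G)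
closeBlock-valid a σ v G d pos (v<a ∷ v<σ) G⊆σ validG =
  valid-++ validG ((newFamily ∷ []) , ([] ∷ [])) fresh
  where
  β : List ℕ
  β = a ∷ σ ++ [ v ]
  a∉σ : a ∉ σ
  a∉σ a∈ = All.lookup (AllPairs.head d) (∈-++⁺ˡ a∈) refl
  v∉σ : v ∉ σ
  v∉σ v∈ = <-irrefl refl (All.lookup v<σ v∈)
  newFamily : IsNonsingletFamily (colourAt a (unused G β))
  newFamily = colourAt-nonsinglet a v (unused G β)
    (AllPairs.filter⁺ (notIn? (range G)) (sort-increasing d))
    (All.tabulate λ x∈ → All.lookup pos (proj₁ (unused⁻ G β x∈)))
    (unused⁺ G β (here refl) (λ a∈ → a∉σ (G⊆σ a∈)))
    (unused⁺ G β (there (∈-++⁺ʳ σ (here refl))) (λ v∈ → v∉σ (G⊆σ v∈)))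
    v<a
  fresh : ∀ {x} → x ∈ range G → x ∉ range [ colourAt a (unused G β) ]
  fresh x∈G x∈F = proj₂ (newFamily⁻ a β G (subst (_ ∈_) (++-identityʳ _) x∈F)) x∈G

encode-valid : ∀ f w → length w < f → Distinct w → Positive w → IsStrippedRegistry (encode f w)
encode-valid (suc f) w (s≤s len) d =
  block-induction (λ w → length w ≤ f → Positive w → IsStrippedRegistry (encode (suc f) w))
                  (λ _ _ → [] , []) step w d len
  where
  step : ∀ pre v post → Distinct (pre ++ v ∷ post) → All (v <_) pre → All (v <_) post →
         blocks (pre ++ v ∷ post) ≡ (pre ++ [ v ]) ∷ blocks post →
         (length post ≤ f → Positive post → IsStrippedRegistry (encode (suc f) post)) →
         length (pre ++ v ∷ post) ≤ f → Positive (pre ++ v ∷ post) → IsStrippedRegistry (encode (suc f) (pre ++ v ∷ post))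
  step [] v post d _ _ bl ih len pos =
    subst IsStrippedRegistry (sym (encode-first-block f (v ∷ post) [ v ] post bl))
      (ih (≤-trans (n≤1+n _) len) (All.tail pos))
  step (a ∷ σ) v post d v<pre _ bl ih len pos =
    subst IsStrippedRegistry (sym (encode-block-cons f a σ v post bl))
      (valid-++ validBlock (ih (≤-trans (<⇒≤ (rest-shorter (a ∷ σ) v post)) len) (proj₂ pos′)) apart)
    where
    β : List ℕ
    β = a ∷ σ ++ [ v ]
    parts : Distinct β × Distinct σ × (∀ {x} → x ∈ β → x ∉ post)
    parts = block-distinct a σ v post d
    pos′ : Positive β × Positive post
    pos′ = All.++⁻ β (subst Positive (first-block-++ a σ v post) pos)
    validBlock : IsStrippedRegistry (closeBlock a β (encode f σ))
    validBlock = closeBlock-valid a σ v (encode f σ) (proj₁ parts) (proj₁ pos′) v<pre (encode-range f σ)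
      (encode-valid f σ (≤-trans (interior-shorter a σ v post) len) (proj₁ (proj₂ parts))
        (proj₁ (All.++⁻ σ (All.tail (proj₁ pos′)))))
    apart : ∀ {x} → x ∈ range (closeBlock a β (encode f σ)) → x ∉ range (encode (suc f) post)
    apart x∈ x∈′ = proj₂ (proj₂ parts) (encodeBlock-range f β (subst (λ R → _ ∈ range R) (sym (encodeBlock-shape f a σ v)) x∈))
                     (encode-range (suc f) post x∈′)

-- The decoder reads the values V of the word in increasing order.  A value v
-- outside the range is a singlet block.  Otherwise v is the last letter of a
-- block whose family F is the first one containing v; the block starts with
-- the smallest red a of F, its interior is decoded from the registry G before
-- F (using the values of G and F other than a), and the rest of the word from
-- the registry after F (using the values outside G and F).

splitAtFamily : ℕ → Registry → Registry × Family × Registry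
splitAtFamily v [] = [] , fam [] [] , []
splitAtFamily v (F ∷ Fs) with v ∈? elems F
... | yes _ = [] , F , Fs
... | no _ = (F ∷ proj₁ (splitAtFamily v Fs)) , proj₂ (splitAtFamily v Fs)

-- the head of a list (0 for the empty list, which never occurs below)
headOr0 : List ℕ → ℕ
headOr0 [] = 0
headOr0 (x ∷ _) = x

headOr0∈ : ∀ {l : List ℕ} → NonEmpty l → headOr0 l ∈ l
headOr0∈ {[]} ne = ⊥-elim (ne refl)
headOr0∈ {x ∷ l} ne = here refl

-- the smallest red of a family, i.e. the first letter of its block
firstRed : Family → ℕ
firstRed F = headOr0 (reds F)

blockValues : Registry → Family → List ℕ
blockValues G F = range G ++ elems F

interior? : (G : Registry) (F : Family) (a : ℕ) → Decidable (λ x → x ∈ blockValues G F × x ≢ a)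
interior? G F a x = (x ∈? blockValues G F) ×-dec ¬? (x ≟ a)

outside? : (G : Registry) (F : Family) → Decidable (_∉ blockValues G F)
outside? G F = notIn? (blockValues G F)

-- the fuel g bounds the recursion depth; any g > length V suffices
mutual
  decode : ℕ → List ℕ → Registry → List ℕ
  decode zero V R = []
  decode (suc g) [] R = []
  decode (suc g) (v ∷ V) R with v ∈? range R
  ... | no _ = v ∷ decode g V R
  ... | yes _ = decodeBlock g v V (splitAtFamily v R)

  decodeBlock : ℕ → ℕ → List ℕ → Registry × Family × Registry → List ℕ
  decodeBlock g v V (G , F , X) =
    (firstRed F ∷ decode g (filter (interior? G F (firstRed F)) V) G) ++ v ∷ decode g (filter (outside? G F) V) X

decode-singlet : ∀ g v V R → v ∉ range R → decode (suc g) (v ∷ V) R ≡ v ∷ decode g V R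
decode-singlet g v V R v∉ with v ∈? range R
... | no _ = refl
... | yes v∈ = ⊥-elim (v∉ v∈)

decode-block : ∀ g v V R → v ∈ range R → decode (suc g) (v ∷ V) R ≡ decodeBlock g v V (splitAtFamily v R)
decode-block g v V R v∈ with v ∈? range R
... | no v∉ = ⊥-elim (v∉ v∈)
... | yes _ = refl

decode-[] : ∀ g → decode g [] [] ≡ []
decode-[] zero = refl
decode-[] (suc g) = refl

splitAtFamily-++ : ∀ v G F X → All (λ H → v ∉ elems H) G → v ∈ elems F → splitAtFamily v (G ++ F ∷ X) ≡ (G , F , X)
splitAtFamily-++ v [] F X _ v∈ with v ∈? elems F
... | yes _ = refl
... | no v∉ = ⊥-elim (v∉ v∈)
splitAtFamily-++ v (H ∷ G) F X (v∉H ∷ v∉G) v∈ with v ∈? elems H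
... | yes v∈H = ⊥-elim (v∉H v∈H)
... | no _ rewrite splitAtFamily-++ v G F X v∉G v∈ = refl

splitAtFamily-spec : ∀ v R → v ∈ range R →
  let (G , F , X) = splitAtFamily v R in R ≡ G ++ F ∷ X × All (λ H → v ∉ elems H) G × v ∈ elems F
splitAtFamily-spec v (F ∷ Fs) v∈ with v ∈? elems F
... | yes v∈F = refl , [] , v∈F
... | no v∉F with ∈-++⁻ (elems F) v∈
... | inj₁ v∈F = ⊥-elim (v∉F v∈F)
... | inj₂ v∈Fs with splitAtFamily-spec v Fs v∈Fs
... | eq , v∉G , v∈F′ = cong (F ∷_) eq , v∉F ∷ v∉G , v∈F′

firstRed-colourAt : ∀ S a → Increasing S → a ∈ S → firstRed (colourAt a S) ≡ a
firstRed-colourAt (x ∷ S) a (px ∷ _) (here refl) rewrite filter-accept (a ≤?_) {x} {S} ≤-refl = refl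
firstRed-colourAt (x ∷ S) a (px ∷ inc) (there a∈)
  rewrite filter-reject (a ≤?_) {x} {S} (λ a≤x → <-irrefl refl (<-≤-trans (All.lookup px a∈) a≤x)) =
  firstRed-colourAt S a inc a∈

filter-≈ : ∀ {P : ℕ → Set} (P? : Decidable P) V Y →
           (∀ {x} → x ∈ V → P x → x ∈ Y) → (∀ {x} → x ∈ Y → x ∈ V × P x) → filter P? V ≈ₛ Y
filter-≈ P? V Y keep found x =
  (λ x∈ → let (x∈V , px) = ∈-filter⁻ P? {xs = V} x∈ in keep x∈V px) ,
  (λ x∈ → let (x∈V , px) = found x∈ in ∈-filter⁺ P? x∈V px)

increasing-≈-head : ∀ {V w v} → Increasing V → V ≈ₛ w → v ∈ w → All (v ≤_) w → ∃ λ V₀ → V ≡ v ∷ V₀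
increasing-≈-head {[]} {v = v} _ e v∈ with () ← proj₂ (e v) v∈
increasing-≈-head {u ∷ V₀} {v = v} inc e v∈ v≤ =
  V₀ , cong (_∷ V₀) (≤-antisym (increasing-head inc (proj₂ (e v) v∈)) (All.lookup v≤ (proj₁ (e u) (here refl))))

tail⁻ : ∀ {v V₀ w x} → Increasing (v ∷ V₀) → (v ∷ V₀) ≈ₛ w → x ∈ V₀ → x ∈ w × x ≢ v
tail⁻ {x = x} (v<V₀ ∷ _) e x∈ = proj₁ (e x) (there x∈) , λ x≡v → <-irrefl (sym x≡v) (All.lookup v<V₀ x∈)

tail⁺ : ∀ {v V₀ w x} → (v ∷ V₀) ≈ₛ w → x ∈ w → x ≢ v → x ∈ V₀
tail⁺ {x = x} e x∈ x≢v with proj₂ (e x) x∈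
... | here x≡v = ⊥-elim (x≢v x≡v)
... | there x∈V₀ = x∈V₀

filter-shorter : ∀ {P : ℕ → Set} (P? : Decidable P) {V g} → length V < g → length (filter P? V) < g
filter-shorter P? {V} = ≤-<-trans (length-filter P? V)

module EncodedBlock (f a : ℕ) (σ : List ℕ) (v : ℕ)
                    (d : Distinct (a ∷ σ ++ [ v ])) (v<aσ : All (v <_) (a ∷ σ)) where

  β : List ℕ
  β = a ∷ σ ++ [ v ]

  G : Registry
  G = encode f σ

  F : Family
  F = colourAt a (unused G β)

  a∉σ : a ∉ σ
  a∉σ a∈ = All.lookup (AllPairs.head d) (∈-++⁺ˡ a∈) refl

  v∉σ : v ∉ σ
  v∉σ v∈ = <-irrefl refl (All.lookup (All.tail v<aσ) v∈)

  v∈F : v ∈ elems F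
  v∈F = colourAt-elems⁺ a _ (unused⁺ G β (there (∈-++⁺ʳ σ (here refl))) λ v∈ → v∉σ (encode-range f σ v∈))

  v∉G : All (λ H → v ∉ elems H) G
  v∉G = All.tabulate λ H∈ v∈ → v∉σ (encode-range f σ (family⊆range G H∈ v∈))

  firstRed-F : firstRed F ≡ a
  firstRed-F = firstRed-colourAt (unused G β) a (AllPairs.filter⁺ (notIn? (range G)) (sort-increasing d))
                 (unused⁺ G β (here refl) λ a∈ → a∉σ (encode-range f σ a∈))

  values-≈ : blockValues G F ≈ₛ β
  values-≈ x = to , from
    where
    to : x ∈ blockValues G F → x ∈ β
    to x∈ with ∈-++⁻ (range G) x∈
    ... | inj₁ x∈G = there (∈-++⁺ˡ (encode-range f σ x∈G))
    ... | inj₂ x∈F = proj₁ (newFamily⁻ a β G x∈F)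
    from : x ∈ β → x ∈ blockValues G F
    from x∈ = subst (x ∈_) (range-snoc G F) (closeBlock-covers a β G x∈)

  closeBlock-++ : ∀ X → closeBlock a β G ++ X ≡ G ++ F ∷ X
  closeBlock-++ X = ++-assoc G [ F ] X

module EncodedWord (f a : ℕ) (σ : List ℕ) (v : ℕ) (post V₀ : List ℕ)
                   (d : Distinct (a ∷ σ ++ v ∷ post)) (v<aσ : All (v <_) (a ∷ σ)) (v<post : All (v <_) post)
                   (inc : Increasing (v ∷ V₀)) (e : (v ∷ V₀) ≈ₛ (a ∷ σ ++ v ∷ post)) where

  parts : Distinct (a ∷ σ ++ [ v ]) × Distinct σ × (∀ {x} → x ∈ a ∷ σ ++ [ v ] → x ∉ post)
  parts = block-distinct a σ v post d

  open EncodedBlock f a σ v (proj₁ parts) v<aσ public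

  w : List ℕ
  w = a ∷ σ ++ v ∷ post

  Vσ Vpost : List ℕ
  Vσ = filter (interior? G F a) V₀
  Vpost = filter (outside? G F) V₀

  in-w : ∀ {x} → x ∈ w → x ∈ β ⊎ x ∈ post
  in-w {x} x∈ = ∈-++⁻ β (subst (x ∈_) (first-block-++ a σ v post) x∈)

  from-β : ∀ {x} → x ∈ β → x ∈ w
  from-β {x} x∈ = subst (x ∈_) (sym (first-block-++ a σ v post)) (∈-++⁺ˡ x∈)

  from-post : ∀ {x} → x ∈ post → x ∈ w
  from-post {x} x∈ = subst (x ∈_) (sym (first-block-++ a σ v post)) (∈-++⁺ʳ β x∈)

  interior-values : Vσ ≈ₛ σ
  interior-values = filter-≈ (interior? G F a) V₀ σ keep found
    where
    keep : ∀ {x} → x ∈ V₀ → x ∈ blockValues G F × x ≢ a → x ∈ σ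
    keep x∈ (x∈GF , x≢a) with block-members {σ = σ} (proj₁ (values-≈ _) x∈GF)
    ... | inj₁ x≡a = ⊥-elim (x≢a x≡a)
    ... | inj₂ (inj₁ x∈σ) = x∈σ
    ... | inj₂ (inj₂ x≡v) = ⊥-elim (proj₂ (tail⁻ inc e x∈) x≡v)
    found : ∀ {x} → x ∈ σ → x ∈ V₀ × x ∈ blockValues G F × x ≢ a
    found x∈ = tail⁺ e (from-β x∈β) (λ { refl → v∉σ x∈ }) , proj₂ (values-≈ _) x∈β , λ { refl → a∉σ x∈ }
      where x∈β = there (∈-++⁺ˡ x∈)

  rest-values : Vpost ≈ₛ post
  rest-values = filter-≈ (outside? G F) V₀ post keep found
    where
    keep : ∀ {x} → x ∈ V₀ → x ∉ blockValues G F → x ∈ post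
    keep x∈ x∉GF with in-w (proj₁ (tail⁻ inc e x∈))
    ... | inj₁ x∈β = ⊥-elim (x∉GF (proj₂ (values-≈ _) x∈β))
    ... | inj₂ x∈post = x∈post
    found : ∀ {x} → x ∈ post → x ∈ V₀ × x ∉ blockValues G F
    found x∈ = tail⁺ e (from-post x∈) (λ { refl → <-irrefl refl (All.lookup v<post x∈) }) ,
               λ x∈GF → proj₂ (proj₂ parts) (proj₁ (values-≈ _) x∈GF) x∈

decode-encode-block : ∀ f g a σ v post V₀ →
  Distinct (a ∷ σ ++ v ∷ post) → All (v <_) (a ∷ σ) → All (v <_) post →
  blocks (a ∷ σ ++ v ∷ post) ≡ (a ∷ σ ++ [ v ]) ∷ blocks post →
  length V₀ < g → Increasing (v ∷ V₀) → (v ∷ V₀) ≈ₛ (a ∷ σ ++ v ∷ post) →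
  (∀ V → length V < g → Increasing V → V ≈ₛ σ → decode g V (encode f σ) ≡ σ) →
  (∀ V → length V < g → Increasing V → V ≈ₛ post → decode g V (encode (suc f) post) ≡ post) →
  decode (suc g) (v ∷ V₀) (encode (suc f) (a ∷ σ ++ v ∷ post)) ≡ a ∷ σ ++ v ∷ post
decode-encode-block f g a σ v post V₀ d v<aσ v<post bl len inc e decodeσ decodePost = begin
  decode (suc g) (v ∷ V₀) (encode (suc f) w)        ≡⟨ cong (decode (suc g) (v ∷ V₀)) encoded ⟩
  decode (suc g) (v ∷ V₀) (G ++ F ∷ R)              ≡⟨ decode-block g v V₀ (G ++ F ∷ R) (∈range-++⁺ʳ G {F ∷ R} (∈-++⁺ˡ v∈F)) ⟩
  decodeBlock g v V₀ (splitAtFamily v (G ++ F ∷ R)) ≡⟨ cong (decodeBlock g v V₀) (splitAtFamily-++ v G F R v∉G v∈F) ⟩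
  decodeBlock g v V₀ (G , F , R)                    ≡⟨ cong (λ r → (r ∷ decode g (filter (interior? G F r) V₀) G) ++ v ∷ decode g Vpost R) firstRed-F ⟩
  (a ∷ decode g Vσ G) ++ v ∷ decode g Vpost R       ≡⟨ cong₂ (λ s p → (a ∷ s) ++ v ∷ p) interior rest ⟩
  w ∎
  where
  open ≡-Reasoning
  open EncodedWord f a σ v post V₀ d v<aσ v<post inc e
  R : Registry
  R = encode (suc f) post
  encoded : encode (suc f) w ≡ G ++ F ∷ R
  encoded = trans (encode-block-cons f a σ v post bl) (closeBlock-++ R)
  interior : decode g Vσ G ≡ σ
  interior = decodeσ Vσ (filter-shorter (interior? G F a) {V₀} len)
                     (AllPairs.filter⁺ (interior? G F a) (AllPairs.tail inc)) interior-values
  rest : decode g Vpost R ≡ post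
  rest = decodePost Vpost (filter-shorter (outside? G F) {V₀} len)
                    (AllPairs.filter⁺ (outside? G F) (AllPairs.tail inc)) rest-values

decode-encode : ∀ f w → length w < f → Distinct w →
                ∀ g V → length V < g → Increasing V → V ≈ₛ w → decode g V (encode f w) ≡ w
decode-encode (suc f) w (s≤s len) d = block-induction P base step w d len
  where
  P : List ℕ → Set
  P w = length w ≤ f → ∀ g V → length V < g → Increasing V → V ≈ₛ w → decode g V (encode (suc f) w) ≡ w
  base : P []
  base _ g [] _ _ _ = decode-[] g
  base _ g (x ∷ V) _ _ e with () ← proj₁ (e x) (here refl)
  step : ∀ pre v post → Distinct (pre ++ v ∷ post) → All (v <_) pre → All (v <_) post →
         blocks (pre ++ v ∷ post) ≡ (pre ++ [ v ]) ∷ blocks post → P post → P (pre ++ v ∷ post)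
  step pre v post d v<pre v<post bl ih len g V lenV inc e
    with increasing-≈-head inc e (∈-++⁺ʳ pre (here refl)) (All.++⁺ (All.map <⇒≤ v<pre) (≤-refl ∷ All.map <⇒≤ v<post))
  step [] v post d v<pre v<post bl ih len (suc g) V (s≤s lenV) inc e | V₀ , refl = begin
    decode (suc g) (v ∷ V₀) (encode (suc f) (v ∷ post)) ≡⟨ cong (decode (suc g) (v ∷ V₀)) (encode-first-block f (v ∷ post) [ v ] post bl) ⟩
    decode (suc g) (v ∷ V₀) (encode (suc f) post)       ≡⟨ decode-singlet g v V₀ _ (λ v∈ → <-irrefl refl (All.lookup v<post (encode-range (suc f) post v∈))) ⟩
    v ∷ decode g V₀ (encode (suc f) post)               ≡⟨ cong (v ∷_) (ih (≤-trans (n≤1+n _) len) g V₀ lenV (AllPairs.tail inc) V₀≈post) ⟩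
    v ∷ post ∎
    where
    open ≡-Reasoning
    V₀≈post : V₀ ≈ₛ post
    V₀≈post x = (λ x∈ → in-post (tail⁻ inc e x∈)) , (λ x∈ → tail⁺ e (there x∈) λ { refl → <-irrefl refl (All.lookup v<post x∈) })
      where
      in-post : x ∈ v ∷ post × x ≢ v → x ∈ post
      in-post (here x≡v , x≢v) = ⊥-elim (x≢v x≡v)
      in-post (there x∈ , _) = x∈
  step (a ∷ σ) v post d v<pre v<post bl ih len (suc g) V (s≤s lenV) inc e | V₀ , refl =
    decode-encode-block f g a σ v post V₀ d v<pre v<post bl lenV inc e
      (decode-encode f σ (≤-trans (interior-shorter a σ v post) len) (proj₁ (proj₂ (block-distinct a σ v post d))) g)
      (ih (≤-trans (<⇒≤ (rest-shorter (a ∷ σ) v post)) len) g)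

module NonsingletFamily {F : Family} (isF : IsNonsingletFamily F) where

  reds-increasing : Increasing (reds F)
  reds-increasing = proj₁ isF

  blues-increasing : Increasing (blues F)
  blues-increasing = proj₁ (proj₂ isF)

  positive : Positive (elems F)
  positive = proj₁ (proj₂ (proj₂ (proj₂ (proj₂ isF))))

  blue<red : ∀ {r b} → r ∈ reds F → b ∈ blues F → b < r
  blue<red r∈ b∈ = All.lookup (All.lookup (proj₂ (proj₂ (proj₂ (proj₂ (proj₂ isF))))) r∈) b∈

  firstRed∈ : firstRed F ∈ reds F
  firstRed∈ = headOr0∈ (proj₁ (proj₂ (proj₂ isF)))

  someBlue∈ : headOr0 (blues F) ∈ blues F
  someBlue∈ = headOr0∈ (proj₁ (proj₂ (proj₂ (proj₂ isF))))

  firstRed≤ : ∀ {r} → r ∈ reds F → firstRed F ≤ r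
  firstRed≤ {r} r∈ with reds F | reds-increasing
  ... | x ∷ xs | inc = increasing-head inc r∈

  blue<firstRed : ∀ {b} → b ∈ blues F → b < firstRed F
  blue<firstRed = blue<red firstRed∈

  colourAt-recovers : ∀ {S} → Increasing S → S ≈ₛ elems F → colourAt (firstRed F) S ≡ F
  colourAt-recovers {S} inc S≈F =
    cong₂ fam (increasing-unique (AllPairs.filter⁺ (a ≤?_) inc) reds-increasing redsMatch)
              (increasing-unique (AllPairs.filter⁺ (_<? a) inc) blues-increasing bluesMatch)
    where
    a : ℕ
    a = firstRed F
    inS : ∀ {x} → x ∈ elems F → x ∈ S
    inS {x} = proj₂ (S≈F x)
    inF : ∀ {x} → x ∈ S → x ∈ reds F ⊎ x ∈ blues F
    inF {x} x∈ = ∈-++⁻ (reds F) (proj₁ (S≈F x) x∈)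
    redsMatch : filter (a ≤?_) S ≈ₛ reds F
    redsMatch = filter-≈ (a ≤?_) S (reds F) keep found
      where
      keep : ∀ {x} → x ∈ S → a ≤ x → x ∈ reds F
      keep x∈ a≤x with inF x∈
      ... | inj₁ x∈r = x∈r
      ... | inj₂ x∈b = ⊥-elim (<-irrefl refl (<-≤-trans (blue<firstRed x∈b) a≤x))
      found : ∀ {x} → x ∈ reds F → x ∈ S × a ≤ x
      found x∈ = inS (∈-++⁺ˡ x∈) , firstRed≤ x∈
    bluesMatch : filter (_<? a) S ≈ₛ blues F
    bluesMatch = filter-≈ (_<? a) S (blues F) keep found
      where
      keep : ∀ {x} → x ∈ S → x < a → x ∈ blues F
      keep x∈ x<a with inF x∈
      ... | inj₁ x∈r = ⊥-elim (<-irrefl refl (<-≤-trans x<a (firstRed≤ x∈r)))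
      ... | inj₂ x∈b = x∈b
      found : ∀ {x} → x ∈ blues F → x ∈ S × x < a
      found x∈ = inS (∈-++⁺ʳ (reds F) x∈) , blue<firstRed x∈

Inverts : List ℕ → List ℕ → Registry → Set
Inverts π V R = Distinct π × π ≈ₛ V × (∀ f → length π < f → encode f π ≡ R)

module RegistryBlock (v : ℕ) (V₀ : List ℕ) (G : Registry) (F : Family) (X : Registry)
                     (inc : Increasing (v ∷ V₀)) (valid : IsStrippedRegistry (G ++ F ∷ X))
                     (R⊆V : Sub (range (G ++ F ∷ X)) (v ∷ V₀))
                     (v∉G : All (λ H → v ∉ elems H) G) (v∈F : v ∈ elems F) where

  R : Registry
  R = G ++ F ∷ X

  a : ℕ
  a = firstRed F

  Vσ Vpost : List ℕ
  Vσ = filter (interior? G F a) V₀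
  Vpost = filter (outside? G F) V₀

  splitG : IsStrippedRegistry G × IsStrippedRegistry (F ∷ X) × (∀ {x} → x ∈ range G → x ∉ range (F ∷ X))
  splitG = valid-++⁻ G valid
  splitF : IsStrippedRegistry [ F ] × IsStrippedRegistry X × (∀ {x} → x ∈ range [ F ] → x ∉ range X)
  splitF = valid-++⁻ [ F ] (proj₁ (proj₂ splitG))

  validG : IsStrippedRegistry G
  validG = proj₁ splitG

  validX : IsStrippedRegistry X
  validX = proj₁ (proj₂ splitF)

  isF : IsNonsingletFamily F
  isF = All.head (proj₁ (proj₁ splitF))

  open NonsingletFamily isF

  G∩F : ∀ {x} → x ∈ range G → x ∉ elems F
  G∩F x∈G x∈F = proj₂ (proj₂ splitG) x∈G (∈-++⁺ˡ x∈F)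

  G∩X : ∀ {x} → x ∈ range G → x ∉ range X
  G∩X x∈G x∈X = proj₂ (proj₂ splitG) x∈G (∈-++⁺ʳ (elems F) x∈X)

  F∩X : ∀ {x} → x ∈ elems F → x ∉ range X
  F∩X x∈F = proj₂ (proj₂ splitF) (∈-++⁺ˡ x∈F)

  F⊆R : Sub (elems F) (range R)
  F⊆R x∈ = ∈range-++⁺ʳ G {F ∷ X} (∈-++⁺ˡ x∈)

  v-least : ∀ {x} → x ∈ range R → v ≤ x
  v-least x∈ = increasing-head inc (R⊆V x∈)

  into-V₀ : ∀ {x} → x ∈ range R → x ≢ v → x ∈ V₀
  into-V₀ x∈ x≢v with R⊆V x∈
  ... | here x≡v = ⊥-elim (x≢v x≡v)
  ... | there x∈V₀ = x∈V₀

  above-v : ∀ {x} → x ∈ V₀ → v < x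
  above-v = All.lookup (AllPairs.head inc)

  -- being least, v is blue, hence below the first red a
  v<a : v < a
  v<a with ∈-++⁻ (reds F) v∈F
  ... | inj₂ v∈b = blue<firstRed v∈b
  ... | inj₁ v∈r = ⊥-elim (<-irrefl refl (<-≤-trans (blue<red v∈r someBlue∈) (v-least (F⊆R (∈-++⁺ʳ (reds F) someBlue∈)))))

  a∈F : a ∈ elems F
  a∈F = ∈-++⁺ˡ firstRed∈

  a∈V₀ : a ∈ V₀
  a∈V₀ = into-V₀ (F⊆R a∈F) λ a≡v → <-irrefl (sym a≡v) v<a

  G⊆Vσ : Sub (range G) Vσ
  G⊆Vσ {x} x∈G = ∈-filter⁺ (interior? G F a) (into-V₀ (∈range-++⁺ˡ G x∈G) x≢v) (∈-++⁺ˡ x∈G , λ { refl → G∩F x∈G a∈F })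
    where
    x≢v : x ≢ v
    x≢v refl with range⊆families G x∈G
    ... | H , H∈ , v∈H = All.lookup v∉G H∈ v∈H

  X⊆Vpost : Sub (range X) Vpost
  X⊆Vpost {x} x∈X = ∈-filter⁺ (outside? G F) (into-V₀ (∈range-++⁺ʳ G {F ∷ X} (∈-++⁺ʳ (elems F) x∈X)) λ { refl → F∩X v∈F x∈X })
                      λ x∈GF → either (λ x∈G → G∩X x∈G x∈X) (λ x∈F → F∩X x∈F x∈X) (∈-++⁻ (range G) x∈GF)

  module Candidate {σ π₂ : List ℕ} (σ≈ : σ ≈ₛ Vσ) (π₂≈ : π₂ ≈ₛ Vpost) where

    β π : List ℕ
    β = a ∷ σ ++ [ v ]
    π = (a ∷ σ) ++ v ∷ π₂

    σ⁻ : ∀ {x} → x ∈ σ → x ∈ V₀ × x ∈ blockValues G F × x ≢ a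
    σ⁻ {x} x∈ = ∈-filter⁻ (interior? G F a) {xs = V₀} (proj₁ (σ≈ x) x∈)

    σ⁺ : ∀ {x} → x ∈ V₀ → x ∈ blockValues G F → x ≢ a → x ∈ σ
    σ⁺ {x} x∈ x∈GF x≢a = proj₂ (σ≈ x) (∈-filter⁺ (interior? G F a) x∈ (x∈GF , x≢a))

    π₂⁻ : ∀ {x} → x ∈ π₂ → x ∈ V₀ × x ∉ blockValues G F
    π₂⁻ {x} x∈ = ∈-filter⁻ (outside? G F) {xs = V₀} (proj₁ (π₂≈ x) x∈)

    π₂⁺ : ∀ {x} → x ∈ V₀ → x ∉ blockValues G F → x ∈ π₂
    π₂⁺ {x} x∈ x∉ = proj₂ (π₂≈ x) (∈-filter⁺ (outside? G F) x∈ x∉)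

    v<σ : All (v <_) σ
    v<σ = All.tabulate λ x∈ → above-v (proj₁ (σ⁻ x∈))

    v<π₂ : All (v <_) π₂
    v<π₂ = All.tabulate λ x∈ → above-v (proj₁ (π₂⁻ x∈))

    -- v is the minimum of π, so a σ v is its first block
    blocks-π : blocks π ≡ β ∷ blocks π₂
    blocks-π = blocks-first (a ∷ σ) v π₂ (v<a ∷ v<σ) v<π₂

    distinct : Distinct σ → Distinct π₂ → Distinct π
    distinct dσ dπ₂ =
      AllPairs.++⁺ (All.tabulate (λ x∈ a≡x → proj₂ (proj₂ (σ⁻ x∈)) (sym a≡x)) ∷ dσ)
                   (All.tabulate (λ x∈ v≡x → <-irrefl v≡x (All.lookup v<π₂ x∈)) ∷ dπ₂)
                   (All.tabulate λ x∈ → All.tabulate (apart x∈))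
      where
      in-block : ∀ {x} → x ∈ a ∷ σ → x ∈ blockValues G F
      in-block (here refl) = ∈-++⁺ʳ (range G) a∈F
      in-block (there x∈) = proj₁ (proj₂ (σ⁻ x∈))
      apart : ∀ {x y} → x ∈ a ∷ σ → y ∈ v ∷ π₂ → x ≢ y
      apart (here refl) (here refl) = λ a≡v → <-irrefl (sym a≡v) v<a
      apart (there x∈) (here refl) = λ x≡v → <-irrefl (sym x≡v) (All.lookup v<σ x∈)
      apart x∈ (there y∈) refl = proj₂ (π₂⁻ y∈) (in-block x∈)

    members : π ≈ₛ (v ∷ V₀)
    members x = to , from
      where
      to : x ∈ π → x ∈ v ∷ V₀
      to x∈ with ∈-++⁻ (a ∷ σ) x∈
      ... | inj₁ (here refl) = there a∈V₀
      ... | inj₁ (there x∈σ) = there (proj₁ (σ⁻ x∈σ))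
      ... | inj₂ (here x≡v) = here x≡v
      ... | inj₂ (there x∈π₂) = there (proj₁ (π₂⁻ x∈π₂))
      from : x ∈ v ∷ V₀ → x ∈ π
      from (here x≡v) = ∈-++⁺ʳ (a ∷ σ) (here x≡v)
      from (there x∈) with x ∈? blockValues G F | x ≟ a
      ... | no x∉GF | _ = ∈-++⁺ʳ (a ∷ σ) (there (π₂⁺ x∈ x∉GF))
      ... | yes _ | yes x≡a = here x≡a
      ... | yes x∈GF | no x≢a = there (∈-++⁺ˡ (σ⁺ x∈ x∈GF x≢a))

    unused≈F : unused G β ≈ₛ elems F
    unused≈F x = to , from
      where
      to : x ∈ unused G β → x ∈ elems F
      to x∈ with unused⁻ G β x∈
      ... | x∈β , x∉G with block-members {σ = σ} x∈β
      ... | inj₁ refl = a∈F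
      ... | inj₂ (inj₂ refl) = v∈F
      ... | inj₂ (inj₁ x∈σ) = either (λ x∈G → ⊥-elim (x∉G x∈G)) (λ x∈F → x∈F) (∈-++⁻ (range G) (proj₁ (proj₂ (σ⁻ x∈σ))))
      from : x ∈ elems F → x ∈ unused G β
      from x∈F = unused⁺ G β in-β (λ x∈G → G∩F x∈G x∈F)
        where
        in-β : x ∈ β
        in-β with x ≟ a | x ≟ v
        ... | yes refl | _ = here refl
        ... | no _ | yes refl = there (∈-++⁺ʳ σ (here refl))
        ... | no x≢a | no x≢v = there (∈-++⁺ˡ (σ⁺ (into-V₀ (F⊆R x∈F) x≢v) (∈-++⁺ʳ (range G) x∈F) x≢a))

    closeBlock-recovers : Distinct β → closeBlock a β G ≡ G ++ [ F ]
    closeBlock-recovers dβ =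
      cong (λ F′ → G ++ [ F′ ]) (colourAt-recovers (AllPairs.filter⁺ (notIn? (range G)) (sort-increasing dβ)) unused≈F)

  block-inverts : ∀ {σ π₂} → Inverts σ Vσ G → Inverts π₂ Vpost X → Inverts ((a ∷ σ) ++ v ∷ π₂) (v ∷ V₀) R
  block-inverts {σ} {π₂} (dσ , σ≈ , encσ) (dπ₂ , π₂≈ , encπ₂) = dπ , members , encoded
    where
    open Candidate σ≈ π₂≈
    dπ : Distinct π
    dπ = distinct dσ dπ₂
    encoded : ∀ f → length π < f → encode f π ≡ R
    encoded (suc f) (s≤s len) = begin
      encode (suc f) π                                  ≡⟨ encode-block-cons f a σ v π₂ blocks-π ⟩
      closeBlock a β (encode f σ) ++ encode (suc f) π₂  ≡⟨ cong₂ (λ G′ X′ → closeBlock a β G′ ++ X′) (encσ f σ<f) (encπ₂ (suc f) π₂<f) ⟩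
      closeBlock a β G ++ X                             ≡⟨ cong (_++ X) (closeBlock-recovers (proj₁ (block-distinct a σ v π₂ dπ))) ⟩
      (G ++ [ F ]) ++ X                                 ≡⟨ ++-assoc G [ F ] X ⟩
      R ∎
      where
      open ≡-Reasoning
      σ<f : length σ < f
      σ<f = ≤-trans (interior-shorter a σ v π₂) len
      π₂<f : length π₂ < suc f
      π₂<f = ≤-trans (rest-shorter (a ∷ σ) v π₂) (s≤s (≤-trans (n≤1+n _) len))

empty-range : ∀ R → IsStrippedRegistry R → Sub (range R) [] → R ≡ []
empty-range [] _ _ = refl
empty-range (F ∷ R) ((isF ∷ _) , _) sub with () ← sub (∈-++⁺ˡ (∈-++⁺ˡ (NonsingletFamily.firstRed∈ isF)))

singlet-inverts : ∀ {v V₀ R π} → All (v <_) V₀ → Inverts π V₀ R → Inverts (v ∷ π) (v ∷ V₀) R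
singlet-inverts {v} {V₀} {R} {π} v<V₀ (dπ , π≈ , encπ) = distinct , members , encoded
  where
  v<π : All (v <_) π
  v<π = All.tabulate λ {x} x∈ → All.lookup v<V₀ (proj₁ (π≈ x) x∈)
  distinct : Distinct (v ∷ π)
  distinct = All.tabulate (λ x∈ v≡x → <-irrefl v≡x (All.lookup v<π x∈)) ∷ dπ
  members : (v ∷ π) ≈ₛ (v ∷ V₀)
  members x = (λ { (here x≡v) → here x≡v ; (there x∈) → there (proj₁ (π≈ x) x∈) })
            , (λ { (here x≡v) → here x≡v ; (there x∈) → there (proj₂ (π≈ x) x∈) })
  encoded : ∀ f → length (v ∷ π) < f → encode f (v ∷ π) ≡ R
  encoded (suc f) (s≤s lenπ) =
    trans (encode-first-block f (v ∷ π) [ v ] π (blocks-first [] v π [] v<π)) (encπ (suc f) (m≤n⇒m≤1+n lenπ))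

encode-decode : ∀ g V R → length V < g → Increasing V → IsStrippedRegistry R → Sub (range R) V → Inverts (decode g V R) V R
encode-decode (suc g) [] R _ _ valid sub rewrite empty-range R valid sub =
  [] , (λ _ → (λ ()) , (λ ())) , λ f _ → encode-[] f
encode-decode (suc g) (v ∷ V₀) R (s≤s len) inc valid sub with v ∈? range R
... | no v∉R = singlet-inverts (AllPairs.head inc) (encode-decode g V₀ R len (AllPairs.tail inc) valid R⊆V₀)
  where
  R⊆V₀ : Sub (range R) V₀
  R⊆V₀ x∈ with sub x∈
  ... | here refl = ⊥-elim (v∉R x∈)
  ... | there x∈V₀ = x∈V₀
... | yes v∈R with splitAtFamily v R | splitAtFamily-spec v R v∈R
... | G , F , X | refl , v∉G , v∈F =
  block-inverts (encode-decode g Vσ G (filter-shorter (interior? G F a) {V₀} len) (AllPairs.filter⁺ (interior? G F a) (AllPairs.tail inc)) validG G⊆Vσ)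
                (encode-decode g Vpost X (filter-shorter (outside? G F) {V₀} len) (AllPairs.filter⁺ (outside? G F) (AllPairs.tail inc)) validX X⊆Vpost)
  where open RegistryBlock v V₀ G F X inc valid sub v∉G v∈F

-- relabel the elements of a family by g; relabelFam β is relabel (jthSmallest β)
relabel : (ℕ → ℕ) → Family → Family
relabel g F = fam (map g (reds F)) (map g (blues F))

StrictlyMonotoneOn : (ℕ → ℕ) → List ℕ → Set
StrictlyMonotoneOn g W = ∀ {x y} → x ∈ W → y ∈ W → x < y → g x < g y

filter-map : ∀ {P Q : ℕ → Set} (P? : Decidable P) (Q? : Decidable Q) g l →
             (∀ {x} → x ∈ l → (P (g x) → Q x) × (Q x → P (g x))) → filter P? (map g l) ≡ map g (filter Q? l)
filter-map P? Q? g [] _ = refl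
filter-map P? Q? g (x ∷ l) corr with Q? x
... | yes qx rewrite filter-accept P? {g x} {map g l} (proj₂ (corr (here refl)) qx) =
  cong (g x ∷_) (filter-map P? Q? g l (λ x∈ → corr (there x∈)))
... | no ¬qx rewrite filter-reject P? {g x} {map g l} (λ p → ¬qx (proj₁ (corr (here refl)) p)) =
  filter-map P? Q? g l (λ x∈ → corr (there x∈))

module Relabelling (g : ℕ → ℕ) (W : List ℕ) (mono : StrictlyMonotoneOn g W) where

  reflects-< : ∀ {x y} → x ∈ W → y ∈ W → g x < g y → x < y
  reflects-< {x} {y} x∈ y∈ gx<gy with <-cmp x y
  ... | tri< x<y _ _ = x<y
  ... | tri≈ _ refl _ = ⊥-elim (<-irrefl refl gx<gy)
  ... | tri> _ _ y<x = ⊥-elim (<-asym gx<gy (mono y∈ x∈ y<x))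

  preserves-≤ : ∀ {x y} → x ∈ W → y ∈ W → x ≤ y → g x ≤ g y
  preserves-≤ x∈ y∈ x≤y = ≮⇒≥ λ gy<gx → <⇒≱ (reflects-< y∈ x∈ gy<gx) x≤y

  reflects-≤ : ∀ {x y} → x ∈ W → y ∈ W → g x ≤ g y → x ≤ y
  reflects-≤ x∈ y∈ gx≤gy = ≮⇒≥ λ y<x → <⇒≱ (mono y∈ x∈ y<x) gx≤gy

  injective : ∀ {x y} → x ∈ W → y ∈ W → g x ≡ g y → x ≡ y
  injective x∈ y∈ gx≡gy = ≤-antisym (reflects-≤ x∈ y∈ (≤-reflexive gx≡gy)) (reflects-≤ y∈ x∈ (≤-reflexive (sym gx≡gy)))

  minimum-map : ∀ x xs → Sub (x ∷ xs) W → minimum (g x) (map g xs) ≡ g (minimum x xs)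
  minimum-map x xs sub with minimum-spec x xs
  ... | m∈ , m≤ = minimum-unique (∈-map⁺ g m∈) (All.tabulate bound)
    where
    bound : ∀ {y} → y ∈ g x ∷ map g xs → g (minimum x xs) ≤ y
    bound y∈ with ∈-map⁻ g {xs = x ∷ xs} y∈
    ... | z , z∈ , refl = preserves-≤ (sub m∈) (sub z∈) (All.lookup m≤ z∈)

  cutAfter-map : ∀ m w → m ∈ W → Sub w W →
                 cutAfter (g m) (map g w) ≡ (map g (proj₁ (cutAfter m w)) , map g (proj₂ (cutAfter m w)))
  cutAfter-map m [] _ _ = refl
  cutAfter-map m (x ∷ w) m∈ sub with x ≟ m | g x ≟ g m
  ... | yes _ | yes _ = refl
  ... | yes x≡m | no gx≢gm = ⊥-elim (gx≢gm (cong g x≡m))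
  ... | no x≢m | yes gx≡gm = ⊥-elim (x≢m (injective (sub (here refl)) m∈ gx≡gm))
  ... | no _ | no _ rewrite cutAfter-map m w m∈ (λ z∈ → sub (there z∈)) = refl

  blocks-map : ∀ w → Sub w W → blocks (map g w) ≡ map (map g) (blocks w)
  blocks-map w sub rewrite length-map g w = go (length w) w sub
    where
    go : ∀ k w → Sub w W → blocksFuel k (map g w) ≡ map (map g) (blocksFuel k w)
    go zero w _ = refl
    go (suc k) [] _ = refl
    go (suc k) (x ∷ xs) sub rewrite minimum-map x xs sub | cutAfter-map (minimum x xs) (x ∷ xs) (sub (proj₁ (minimum-spec x xs))) sub =
      cong (_ ∷_) (go k _ λ z∈ → sub (subst (_ ∈_) (cutAfter-++-both (minimum x xs) (x ∷ xs)) (∈-++⁺ʳ _ z∈)))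

  dropLast-map : ∀ y ys → dropLast (g y) (map g ys) ≡ map g (dropLast y ys)
  dropLast-map y [] = refl
  dropLast-map y (z ∷ zs) = cong (g y ∷_) (dropLast-map z zs)

  range-map : ∀ R → range (map (relabel g) R) ≡ map g (range R)
  range-map [] = refl
  range-map (F ∷ R) rewrite range-map R =
    sym (trans (map-++ g (elems F) (range R)) (cong (_++ map g (range R)) (map-++ g (reds F) (blues F))))

  sort-map : ∀ β → Sub β W → sort (map g β) ≡ map g (sort β)
  sort-map β sub = sort-unique (sorted-map (λ x∈ → sub (∈sort⁻ x∈)) (sort-↗ β)) (map⁺ g (↭-sym (sort-↭ β)))
    where
    sorted-map : ∀ {l} → Sub l W → Sorted l → Sorted (map g l)
    sorted-map _ [] = []
    sorted-map _ [-] = [-]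
    sorted-map sub (x≤y ∷ rest) = preserves-≤ (sub (here refl)) (sub (there (here refl))) x≤y ∷ sorted-map (λ z∈ → sub (there z∈)) rest

  colourAt-map : ∀ a S → a ∈ W → Sub S W → colourAt (g a) (map g S) ≡ relabel g (colourAt a S)
  colourAt-map a S a∈ S⊆W =
    cong₂ fam (filter-map (g a ≤?_) (a ≤?_) g S λ x∈ → reflects-≤ a∈ (S⊆W x∈) , preserves-≤ a∈ (S⊆W x∈))
              (filter-map (_<? g a) (_<? a) g S λ x∈ → reflects-< (S⊆W x∈) a∈ , mono (S⊆W x∈) a∈)

  unused-map : ∀ β G → Sub β W → Sub (range G) W → unused (map (relabel g) G) (map g β) ≡ map g (unused G β)
  unused-map β G β⊆W G⊆W rewrite range-map G | sort-map β β⊆W =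
    filter-map (notIn? (map g (range G))) (notIn? (range G)) g (sort β) λ x∈ → (λ gx∉ x∈G → gx∉ (∈-map⁺ g x∈G)) , fresh x∈
    where
    fresh : ∀ {x} → x ∈ sort β → x ∉ range G → g x ∉ map g (range G)
    fresh x∈ x∉G gx∈ with ∈-map⁻ g gx∈
    ... | z , z∈G , gx≡gz = x∉G (subst (_∈ range G) (sym (injective (β⊆W (∈sort⁻ x∈)) (G⊆W z∈G) gx≡gz)) z∈G)

  closeBlock-map : ∀ a β G → a ∈ W → Sub β W → Sub (range G) W →
                   closeBlock (g a) (map g β) (map (relabel g) G) ≡ map (relabel g) (closeBlock a β G)
  closeBlock-map a β G a∈ β⊆W G⊆W = begin
    map (relabel g) G ++ [ colourAt (g a) (unused (map (relabel g) G) (map g β)) ]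
      ≡⟨ cong (λ S → map (relabel g) G ++ [ colourAt (g a) S ]) (unused-map β G β⊆W G⊆W) ⟩
    map (relabel g) G ++ [ colourAt (g a) (map g (unused G β)) ]
      ≡⟨ cong (λ F → map (relabel g) G ++ [ F ]) (colourAt-map a (unused G β) a∈ λ x∈ → β⊆W (proj₁ (unused⁻ G β x∈))) ⟩
    map (relabel g) G ++ [ relabel g (colourAt a (unused G β)) ]
      ≡⟨ sym (map-++ (relabel g) G [ colourAt a (unused G β) ]) ⟩
    map (relabel g) (closeBlock a β G) ∎
    where open ≡-Reasoning

  mutual
    encode-map : ∀ f w → Sub w W → encode f (map g w) ≡ map (relabel g) (encode f w)
    encode-map zero w _ = refl
    encode-map (suc f) w sub = begin
      concat (map (encodeBlock f) (blocks (map g w)))            ≡⟨ cong (λ bs → concat (map (encodeBlock f) bs)) (blocks-map w sub) ⟩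
      concat (map (encodeBlock f) (map (map g) (blocks w)))      ≡⟨ cong concat (sym (map-∘ (blocks w))) ⟩
      concat (map (λ β → encodeBlock f (map g β)) (blocks w))    ≡⟨ cong concat (map-cong-local (All.map (λ {β} (β⊆w , _) → encodeBlock-map f β (λ x∈ → sub (β⊆w x∈))) (blocks-sublists w))) ⟩
      concat (map (λ β → map (relabel g) (encodeBlock f β)) (blocks w)) ≡⟨ cong concat (map-∘ (blocks w)) ⟩
      concat (map (map (relabel g)) (map (encodeBlock f) (blocks w))) ≡⟨ concat-map (map (encodeBlock f) (blocks w)) ⟩
      map (relabel g) (concat (map (encodeBlock f) (blocks w))) ∎
      where open ≡-Reasoning

    encodeBlock-map : ∀ f β → Sub β W → encodeBlock f (map g β) ≡ map (relabel g) (encodeBlock f β)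
    encodeBlock-map f [] _ = refl
    encodeBlock-map f (x ∷ []) _ = refl
    encodeBlock-map f (a ∷ y ∷ ys) sub
      rewrite dropLast-map y ys | encode-map f (dropLast y ys) (λ x∈ → sub (there (dropLast-sub y ys x∈))) =
      closeBlock-map a (a ∷ y ∷ ys) (encode f (dropLast y ys)) (sub (here refl)) sub
        (λ x∈ → sub (there (dropLast-sub y ys (encode-range f (dropLast y ys) x∈))))

-- Patterns: a distinct word is the image of its pattern under the increasing map jthSmallest.

nth-rank : ∀ s {x} → Increasing s → x ∈ s → nth s (suc (length (filter (_<? x) s))) ≡ x
nth-rank (y ∷ s) (y<s ∷ _) (here refl)
  rewrite filter-reject (_<? y) {y} {s} (<-irrefl refl)
        | filter-none (_<? y) {s} (All.map (λ y<z z<y → <-asym y<z z<y) y<s) = refl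
nth-rank (y ∷ s) {x} (y<s ∷ inc) (there x∈) rewrite filter-accept (_<? x) {y} {s} (All.lookup y<s x∈)
  with filter (_<? x) s | nth-rank s inc x∈
... | [] | ih = ih
... | _ ∷ _ | ih = ih

jthSmallest-rank : ∀ β → Distinct β → ∀ {x} → x ∈ β → jthSmallest β (rank β x) ≡ x
jthSmallest-rank β d {x} x∈ rewrite ↭-length (filter-↭ (_<? x) (↭-sym (sort-↭ β))) =
  nth-rank (sort β) (sort-increasing d) (∈sort⁺ x∈)

rank-mono : ∀ β {x y} → x ≤ y → rank β x ≤ rank β y
rank-mono β x≤y = s≤s (length-mono-≤ (sublist-filter⁺ (_<? _) (_<? _) (λ { refl z<x → <-≤-trans z<x x≤y }) (⊆-refl {x = β})))

jthSmallest-monotone : ∀ β → Distinct β → StrictlyMonotoneOn (jthSmallest β) (patternOf β)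
jthSmallest-monotone β d x∈ y∈ x<y with ∈-map⁻ (rank β) x∈ | ∈-map⁻ (rank β) y∈
... | u , u∈ , refl | u′ , u′∈ , refl rewrite jthSmallest-rank β d u∈ | jthSmallest-rank β d u′∈ =
  ≰⇒> λ u′≤u → <-irrefl refl (<-≤-trans x<y (rank-mono β u′≤u))

relabel-pattern : ∀ β → Distinct β → map (jthSmallest β) (patternOf β) ≡ β
relabel-pattern β d = trans (sym (map-∘ β)) (map-id-local (All.tabulate (jthSmallest-rank β d)))

-- Φₙ encodes a permutation with enough fuel; it does not depend on n
Φ : ℕ → List ℕ → Registry
Φ _ π = encode (suc (length π)) π

BlockShape : List ℕ → Set
BlockShape β = ∃₂ λ pre v → β ≡ pre ++ [ v ] × All (v <_) pre × Distinct β

blocks-shape : ∀ w → Distinct w → All BlockShape (blocks w)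
blocks-shape = block-induction (λ w → All BlockShape (blocks w)) [] step
  where
  step : ∀ pre v post → Distinct (pre ++ v ∷ post) → All (v <_) pre → All (v <_) post →
         blocks (pre ++ v ∷ post) ≡ (pre ++ [ v ]) ∷ blocks post →
         All BlockShape (blocks post) → All BlockShape (blocks (pre ++ v ∷ post))
  step pre v post d v<pre _ bl ih =
    subst (All BlockShape) (sym bl)
      ((pre , v , refl , v<pre , proj₁ (allPairs-++⁻ (pre ++ [ v ]) (subst Distinct (sym (++-assoc pre [ v ] post)) d))) ∷ ih)

encodeBlock-pattern : ∀ pre v → All (v <_) pre → Distinct (pre ++ [ v ]) → ∀ k → length (pre ++ [ v ]) ≤ k →
                      encodeBlock k (pre ++ [ v ]) ≡ blockImage Φ (pre ++ [ v ])
encodeBlock-pattern [] v _ _ k _ = refl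
encodeBlock-pattern (a ∷ σ) v v<pre d k len = sym (begin
  blockImage Φ β                                        ≡⟨ image-unfold σ ⟩
  map (relabel g) (encode (suc L) pat)                  ≡⟨ sym (Relabelling.encode-map g pat (jthSmallest-monotone β d) (suc L) pat (λ x∈ → x∈)) ⟩
  encode (suc L) (map g pat)                            ≡⟨ cong (encode (suc L)) (relabel-pattern β d) ⟩
  encode (suc L) β                                      ≡⟨ encode-first-block L β β [] (blocks-first (a ∷ σ) v [] v<pre []) ⟩
  encodeBlock L β ++ []                                 ≡⟨ ++-identityʳ _ ⟩
  encodeBlock L β                                       ≡⟨ encodeBlock-adequate L k β (≤-reflexive (sym (length-map (rank β) β))) len ⟩
  encodeBlock k β ∎)
  where
  open ≡-Reasoning
  β pat : List ℕ
  β = a ∷ σ ++ [ v ]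
  pat = patternOf β
  g : ℕ → ℕ
  g = jthSmallest β
  L : ℕ
  L = length pat
  image-unfold : ∀ τ → blockImage Φ (a ∷ τ ++ [ v ]) ≡ map (relabel (jthSmallest (a ∷ τ ++ [ v ])))
                                                         (encode (suc (length (patternOf (a ∷ τ ++ [ v ])))) (patternOf (a ∷ τ ++ [ v ])))
  image-unfold [] = refl
  image-unfold (_ ∷ _) = refl

Φ-blocks : ∀ n π → Distinct π → Φ n π ≡ concat (map (blockImage Φ) (blocks π))
Φ-blocks _ π d = cong concat (map-cong-local (All.zipWith image (blocks-shape π d , blocks-sublists π)))
  where
  image : ∀ {β} → BlockShape β × (Sub β π × length β ≤ length π) → encodeBlock (length π) β ≡ blockImage Φ β
  image ((pre , v , refl , v<pre , dβ) , _ , len) = encodeBlock-pattern pre v v<pre dβ (length π) len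

interval-increasing : ∀ n → Increasing (interval n)
interval-increasing n = AllPairs.map⁺ (AllPairs.map s≤s (AllPairs.applyUpTo⁺₁ (λ i → i) n (λ i<j _ → i<j)))

∈interval⁻ : ∀ {n x} → x ∈ interval n → 1 ≤ x × x ≤ n
∈interval⁻ x∈ with ∈-map⁻ suc x∈
... | i , i∈ , refl = s≤s z≤n , ∈-upTo⁻ i∈

∈interval⁺ : ∀ {n x} → 1 ≤ x → x ≤ n → x ∈ interval n
∈interval⁺ {x = suc i} _ i<n = ∈-map⁺ suc (∈-upTo⁺ i<n)

interval-length : ∀ n → length (interval n) ≡ n
interval-length n = trans (length-map suc (upTo n)) (length-upTo n)

module Permutation {n π} (perm : IsPerm n π) where

  distinct : Distinct π
  distinct = distinct-resp-↭ (↭-sym perm) (increasing⇒distinct (interval-increasing n))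

  positive : Positive π
  positive = All.tabulate λ x∈ → proj₁ (∈interval⁻ (∈-resp-↭ perm x∈))

  length≡ : length π ≡ n
  length≡ = trans (↭-length perm) (interval-length n)

  values : interval n ≈ₛ π
  values x = ∈-resp-↭ (↭-sym perm) , ∈-resp-↭ perm

-- Φₙ is a bijection: decoding with the values interval n is its inverse.

Φ-bijection : ∀ n → IsBijectionOnto n (Φ n)
Φ-bijection n = valid , injective , surjective
  where
  decode-Φ : ∀ π → IsPerm n π → decode (suc n) (interval n) (Φ n π) ≡ π
  decode-Φ π perm = decode-encode (suc (length π)) π ≤-refl distinct (suc n) (interval n)
                      (s≤s (≤-reflexive (interval-length n))) (interval-increasing n) values
    where open Permutation perm
  valid : ∀ π → IsPerm n π → IsStrippedRegistry (Φ n π) × RangeWithin n (Φ n π)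
  valid π perm = encode-valid (suc (length π)) π ≤-refl distinct positive ,
                 All.tabulate λ x∈ → proj₂ (∈interval⁻ (∈-resp-↭ perm (encode-range (suc (length π)) π x∈)))
    where open Permutation perm
  injective : ∀ π σ → IsPerm n π → IsPerm n σ → Φ n π ≡ Φ n σ → π ≡ σ
  injective π σ pπ pσ eq = trans (sym (decode-Φ π pπ)) (trans (cong (decode (suc n) (interval n)) eq) (decode-Φ σ pσ))
  surjective : ∀ R → IsStrippedRegistry R → RangeWithin n R → ∃ λ π → IsPerm n π × Φ n π ≡ R
  surjective R validR within = π , distinct-≈⇒↭ (proj₁ inv) (interval-increasing n) (proj₁ (proj₂ inv)) ,
                               proj₂ (proj₂ inv) (suc (length π)) ≤-refl
    where
    R⊆interval : Sub (range R) (interval n)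
    R⊆interval x∈ with range⊆families R x∈
    ... | F , F∈ , x∈F = ∈interval⁺ (All.lookup (NonsingletFamily.positive (All.lookup (proj₁ validR) F∈)) x∈F) (All.lookup within x∈)
    π : List ℕ
    π = decode (suc n) (interval n) R
    inv : Inverts π (interval n) R
    inv = encode-decode (suc n) (interval n) R (s≤s (≤-reflexive (interval-length n))) (interval-increasing n) validR R⊆interval

minRange-char : ∀ R {v} → v ∈ range R → All (v ≤_) (range R) → minRange R ≡ v
minRange-char R v∈ v≤ with range R
... | x ∷ xs = minimum-unique v∈ v≤

containsB-true : ∀ v F → v ∈ elems F → containsB v F ≡ true
containsB-true v F v∈ with v ∈? elems F
... | yes _ = refl
... | no v∉ = ⊥-elim (v∉ v∈)

containsB-false : ∀ v F → v ∉ elems F → containsB v F ≡ false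
containsB-false v F v∉ with v ∈? elems F
... | yes v∈ = ⊥-elim (v∉ v∈)
... | no _ = refl

cutRegAfter-++ : ∀ v G F X → All (λ H → v ∉ elems H) G → v ∈ elems F → cutRegAfter v (G ++ F ∷ X) ≡ (G ++ [ F ] , X)
cutRegAfter-++ v [] F X _ v∈ rewrite containsB-true v F v∈ = refl
cutRegAfter-++ v (H ∷ G) F X (v∉H ∷ v∉G) v∈ rewrite containsB-false v H v∉H | cutRegAfter-++ v G F X v∉G v∈ = refl

regBlocksFuel-[] : ∀ k → regBlocksFuel k [] ≡ []
regBlocksFuel-[] zero = refl
regBlocksFuel-[] (suc k) = refl

registryBlocks-one : ∀ R → R ≢ [] → proj₂ (cutRegAfter (minRange R) R) ≡ [] → length (registryBlocks R) ≡ 1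
registryBlocks-one [] R≢[] _ = ⊥-elim (R≢[] refl)
registryBlocks-one (H ∷ Hs) _ rest≡[] rewrite rest≡[] | regBlocksFuel-[] (length Hs) = refl

single-registry-block : ∀ v G F → All (λ H → v ∉ elems H) G → v ∈ elems F → All (v ≤_) (range (G ++ [ F ])) →
                        length (registryBlocks (G ++ [ F ])) ≡ 1
single-registry-block v G F v∉G v∈F v≤ = registryBlocks-one (G ++ [ F ]) nonempty (begin
  proj₂ (cutRegAfter (minRange (G ++ [ F ])) (G ++ [ F ])) ≡⟨ cong (λ m → proj₂ (cutRegAfter m (G ++ [ F ]))) (minRange-char (G ++ [ F ]) v∈R v≤) ⟩
  proj₂ (cutRegAfter v (G ++ [ F ]))                       ≡⟨ cong proj₂ (cutRegAfter-++ v G F [] v∉G v∈F) ⟩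
  [] ∎)
  where
  open ≡-Reasoning
  v∈R : v ∈ range (G ++ [ F ])
  v∈R = ∈range-++⁺ʳ G {[ F ]} (∈-++⁺ˡ v∈F)
  nonempty : G ++ [ F ] ≢ []
  nonempty eq with () ← subst (λ R → v ∈ range R) eq v∈R

one-block-ends : ∀ pre v post → All (v <_) pre → All (v <_) post → length (blocks (pre ++ v ∷ post)) ≡ 1 → post ≡ []
one-block-ends pre v [] _ _ _ = refl
one-block-ends pre v (y ∷ ys) v<pre v<post one
  rewrite blocks-first pre v (y ∷ ys) v<pre v<post with () ← one

single-block-encoding : ∀ p a σ v → IsPerm p (a ∷ σ ++ [ v ]) → All (v <_) (a ∷ σ) →
  RangeIs p (Φ p (a ∷ σ ++ [ v ])) × length (registryBlocks (Φ p (a ∷ σ ++ [ v ]))) ≡ 1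
single-block-encoding p a σ v perm v<aσ =
  subst (λ R → RangeIs p R × length (registryBlocks R) ≡ 1) (sym Φτ≡) (rangeIs , single-registry-block v G F v∉G v∈F v-least)
  where
  τ : List ℕ
  τ = a ∷ σ ++ [ v ]
  open Permutation perm using (distinct)
  open EncodedBlock (length τ) a σ v distinct v<aσ
  Φτ≡ : Φ p τ ≡ G ++ [ F ]
  Φτ≡ = trans (encode-block-cons (length τ) a σ v [] (blocks-first (a ∷ σ) v [] v<aσ [])) (++-identityʳ _)
  range⊆τ : Sub (range (G ++ [ F ])) τ
  range⊆τ x∈ = proj₁ (values-≈ _) (subst (_ ∈_) (range-snoc G F) x∈)
  rangeIs : RangeIs p (G ++ [ F ])
  rangeIs x = (λ x∈ → ∈interval⁻ (∈-resp-↭ perm (range⊆τ x∈))) ,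
              (λ (1≤x , x≤p) → closeBlock-covers a τ G (∈-resp-↭ (↭-sym perm) (∈interval⁺ 1≤x x≤p)))
  v-least : All (v ≤_) (range (G ++ [ F ]))
  v-least = All.tabulate λ x∈ → v≤τ (range⊆τ x∈)
    where
    v≤τ : ∀ {x} → x ∈ τ → v ≤ x
    v≤τ x∈ with block-members {σ = σ} x∈
    ... | inj₁ refl = <⇒≤ (All.head v<aσ)
    ... | inj₂ (inj₁ x∈σ) = <⇒≤ (All.lookup (All.tail v<aσ) x∈σ)
    ... | inj₂ (inj₂ refl) = ≤-refl

single-block : ∀ p → 2 ≤ p → ∀ τ → IsPerm p τ → length (blocks τ) ≡ 1 →
               RangeIs p (Φ p τ) × length (registryBlocks (Φ p τ)) ≡ 1
single-block p 2≤p [] perm _ = ⊥-elim (<-irrefl (Permutation.length≡ perm) (≤-trans (s≤s z≤n) 2≤p))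
single-block p 2≤p (x ∷ xs) perm one with split-at-minimum x xs (Permutation.distinct perm)
... | pre , post , v , eq , v<pre , v<post =
  subst Goal (sym eq) (shaped pre post (subst (IsPerm p) eq perm) v<pre v<post (subst (λ w → length (blocks w) ≡ 1) eq one))
  where
  Goal : List ℕ → Set
  Goal τ = RangeIs p (Φ p τ) × length (registryBlocks (Φ p τ)) ≡ 1
  shaped : ∀ pre post → IsPerm p (pre ++ v ∷ post) → All (v <_) pre → All (v <_) post →
           length (blocks (pre ++ v ∷ post)) ≡ 1 → Goal (pre ++ v ∷ post)
  shaped pre post perm v<pre v<post one with one-block-ends pre v post v<pre v<post one
  shaped [] .[] perm _ _ _ | refl = ⊥-elim (<-irrefl (Permutation.length≡ perm) 2≤p)
  shaped (a ∷ σ) .[] perm v<aσ _ _ | refl = single-block-encoding p a σ v perm v<aσ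

mainTheorem7 :
    Σ (ℕ → List ℕ → Registry) λ Φ →
      (∀ n → 1 ≤ n → IsBijectionOnto n (Φ n)) ×
      (∀ p → 2 ≤ p → ∀ τ → IsPerm p τ → length (blocks τ) ≡ 1 →
         RangeIs p (Φ p τ) × length (registryBlocks (Φ p τ)) ≡ 1) ×
      (∀ n → 1 ≤ n → ∀ π → IsPerm n π →
         Φ n π ≡ concat (map (blockImage Φ) (blocks π)))
mainTheorem7 =
  Φ ,
  (λ n _ → Φ-bijection n) ,
  single-block ,
  (λ n _ π perm → Φ-blocks n π (Permutation.distinct perm))
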